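{- For integers $n\ge d\ge1$ and $k\ge 2^d$, \[d!\,\lambda(H(k,d))\binom{n}{d}\le f(n,k,d)\le \lambda(H(k,d))\,n^d.\] Moreover, equality holds in the upper bound if and only if the Lagrangian polynomial $P_{H(k,d)}$ attains its maximum over the simplex at a point all of whose coordinates lie in $\frac1n\mathbb{Z}$.
   Context: A family $\mathcal{F}$ of subsets of $[n]$ shatters $A\subseteq[n]$ if for every $A'\subseteq A$ there is $F\in\mathcal{F}$ with $F\cap A=A'$; $f(n,k,d)$ is the maximum number of $d$-subsets of $[n]$ shattered by some $\mathcal{F}\subseteq 2^{[n]}$ with $|\mathcal{F}|\le k$. A $k\times d$ binary matrix is shattered if each of the $2^d$ vectors in $\{0,1\}^d$ appears among its rows. $H(k,d)$ is the $d$-uniform hypergraph with vertex set $\{0,1\}^k$ in which $d$ distinct vectors form an edge iff the $k\times d$ matrix having them as columns is shattered. For a $d$-uniform hypergraph $H$, its Lagrangian polynomial is $P_H((x_v)_{v\in V(H)})=\sum_{e\in E(H)}\prod_{v\in e}x_v$, and its Lagrangian $\lambda(H)$ is the maximum of $P_H$ over the simplex $\{x: x_v\ge0,\ \sum_v x_v=1\}$.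
   Formalization: The simplex over which the Lagrangian λ(H(k,d)) and the maximum of $P_{H(k,d)}$ are taken consists only of its points with rational coordinates. -}

module Defs where

open import Data.Bool using (Bool; true; false)
open import Data.Bool.Properties using () renaming (_≟_ to _≟ᵇ_)
open import Data.Nat as ℕ using (ℕ; zero; suc; _⊔_)
open import Data.Integer as ℤ using (ℤ; +_)
open import Data.Rational as ℚ using (ℚ; 0ℚ; 1ℚ)
open import Data.Fin using (Fin)
import Data.Fin.Properties as FinP
open import Data.Fin.Subset using (Subset; _⊆_; _∩_; ∣_∣)
open import Data.Fin.Subset.Properties using (_⊆?_)
open import Data.Vec as Vec using (Vec; []; _∷_; lookup)
import Data.Vec.Properties as VecP
open import Data.List as List using (List; []; _∷_; _++_; [_]; concatMap; filter; length; foldr; upTo)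
open import Data.List.Membership.Propositional using (_∈_)
open import Data.List.Relation.Unary.Any using (Any)
open import Data.Product using (Σ; ∃; _×_; _,_; proj₁; proj₂)
open import Relation.Nullary using (Dec; yes; no; ¬_)
open import Relation.Nullary.Decidable using (map′; _×-dec_; _→-dec_)
open import Relation.Binary.PropositionalEquality using (_≡_; refl)

allVecs : (k : ℕ) → List (Vec Bool k)
allVecs zero    = [ [] ]
allVecs (suc k) = List.map (true ∷_) (allVecs k) ++ List.map (false ∷_) (allVecs k)

-- all d-element sublists (as vectors, in list order) of a list;
-- for a duplicate-free list this lists every d-subset exactly once
combinations : ∀ {A : Set} (d : ℕ) → List A → List (Vec A d)
combinations zero    _        = [ [] ]
combinations (suc d) []       = []
combinations (suc d) (x ∷ xs) =
  List.map (x ∷_) (combinations d xs) ++ combinations (suc d) xs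

listsUpTo : ∀ {A : Set} (m : ℕ) → List A → List (List A)
listsUpTo zero    xs = [ [] ]
listsUpTo (suc m) xs = [] ∷ concatMap (λ a → List.map (a ∷_) (listsUpTo m xs)) xs

allVec? : ∀ {d} {P : Vec Bool d → Set} → (∀ w → Dec (P w)) → Dec (∀ w → P w)
allVec? {zero} P? with P? []
... | yes p = yes λ { [] → p }
... | no ¬p = no λ h → ¬p (h [])
allVec? {suc d} {P} P? with allVec? {d} (λ w → P? (true ∷ w)) | allVec? {d} (λ w → P? (false ∷ w))
... | yes t | yes f = yes λ { (true ∷ w) → t w ; (false ∷ w) → f w }
... | no ¬t | _     = no λ h → ¬t (λ w → h (true ∷ w))
... | yes _ | no ¬f = no λ h → ¬f (λ w → h (false ∷ w))

-- a family of at most k subsets of [n] is given as a list of length ≤ k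
Family : ℕ → Set
Family n = List (Subset n)

Shatters : ∀ {n} → Family n → Subset n → Set
Shatters {n} ℱ A = ∀ (A' : Subset n) → A' ⊆ A → ∃ λ F → F ∈ ℱ × (F ∩ A) ≡ A'

shatters? : ∀ {n} (ℱ : Family n) (A : Subset n) → Dec (Shatters ℱ A)
shatters? {n} ℱ A = allVec? {n} {λ A' → A' ⊆ A → ∃ λ F → F ∈ ℱ × (F ∩ A) ≡ A'} (λ A' → (A' ⊆? A) →-dec any′ A')
  where
  any′ : ∀ A' → Dec (∃ λ F → F ∈ ℱ × (F ∩ A) ≡ A')
  any′ A' = map′ to from (Data.List.Relation.Unary.Any.any? (λ F → VecP.≡-dec _≟ᵇ_ (F ∩ A) A') ℱ)
    where
    open import Data.List.Relation.Unary.Any using (here; there)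
    to : ∀ {ℱ} → Any (λ F → (F ∩ A) ≡ A') ℱ → ∃ λ F → F ∈ ℱ × (F ∩ A) ≡ A'
    to (here p) = _ , here refl , p
    to (there a) with to a
    ... | F , m , p = F , there m , p
    from : ∀ {ℱ} → (∃ λ F → F ∈ ℱ × (F ∩ A) ≡ A') → Any (λ F → (F ∩ A) ≡ A') ℱ
    from (F , here refl , p) = here p
    from (F , there m , p) = there (from (F , m , p))

numShattered : ∀ {n} (d : ℕ) → Family n → ℕ
numShattered {n} d ℱ =
  length (filter (λ A → (ℕ._≟_ ∣ A ∣ d) ×-dec shatters? ℱ A) (allVecs n))

-- f(n,k,d) = max number of d-subsets of [n] shattered by a family of ≤ k subsets
-- (maximum over all lists of ≤ k subsets of [n]; repetitions in a list do not
--  affect shattering, and every family of ≤ k sets is such a list)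
f : ℕ → ℕ → ℕ → ℕ
f n k d = foldr _⊔_ 0 (List.map (numShattered d) (listsUpTo k (allVecs n)))

-- the k × d matrix whose columns are the given vectors of {0,1}^k; its i-th row
row : ∀ {k d} → Vec (Vec Bool k) d → Fin k → Vec Bool d
row M i = Vec.map (λ c → lookup c i) M

MatShattered : ∀ {k d} → Vec (Vec Bool k) d → Set
MatShattered {k} {d} M = ∀ (w : Vec Bool d) → ∃ λ (i : Fin k) → row M i ≡ w

matShattered? : ∀ {k d} (M : Vec (Vec Bool k) d) → Dec (MatShattered M)
matShattered? M = allVec? (λ w → FinP.any? (λ i → VecP.≡-dec _≟ᵇ_ (row M i) w))

-- points of ℚ^{V(H)}, V(H) = {0,1}^k
Point : ℕ → Set
Point k = Vec Bool k → ℚ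

sumℚ : List ℚ → ℚ
sumℚ = foldr ℚ._+_ 0ℚ

prodℚ : ∀ {m} → Vec ℚ m → ℚ
prodℚ = Vec.foldr _ ℚ._*_ 1ℚ

-- Lagrangian polynomial of H(k,d): sum over edges (d-sets of distinct vectors
-- of {0,1}^k forming a shattered matrix) of the product of the coordinates
P : (k d : ℕ) → Point k → ℚ
P k d x = sumℚ (List.map (λ M → prodℚ (Vec.map x M))
                 (filter matShattered? (combinations d (allVecs k))))

InSimplex : ∀ {k} → Point k → Set
InSimplex {k} x = (∀ v → 0ℚ ℚ.≤ x v) × sumℚ (List.map x (allVecs k)) ≡ 1ℚ

ℕ→ℚ : ℕ → ℚ
ℕ→ℚ m = (+ m) ℚ./ 1

-- Comparisons of c · λ(H(k,d)) (c > 0 a natural number) with a number q,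
-- where λ = sup of P over the simplex.  By continuity of P and density of
-- rational points in the simplex, the sup over rational points equals λ.

LagTimesLE : (k d c : ℕ) → ℚ → Set
LagTimesLE k d c q = ∀ (x : Point k) → InSimplex x → ℕ→ℚ c ℚ.* P k d x ℚ.≤ q

-- q ≤ c · λ(H(k,d))
LagTimesGE : (k d c : ℕ) → ℚ → Set
LagTimesGE k d c q = ∀ (r : ℚ) → r ℚ.< q →
  ∃ λ (x : Point k) → InSimplex x × r ℚ.< ℕ→ℚ c ℚ.* P k d x

MaxAt : (k d : ℕ) → Point k → Set
MaxAt k d x = InSimplex x × (∀ (y : Point k) → InSimplex y → P k d y ℚ.≤ P k d x)

InLattice : ∀ {k} → ℕ → Point k → Set
InLattice n x = ∀ v → ∃ λ (z : ℤ) → ℕ→ℚ n ℚ.* x v ≡ z ℚ./ 1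

{-# OPTIONS --safe #-}
-- Encode a family of k subsets of [n] by its n columns a₁ … aₙ ∈ {0,1}ᵏ, column i recording which
-- sets contain i. A d-set S ⊆ [n] is shattered iff the columns aᵢ (i ∈ S) form a shattered matrix;
-- such columns are distinct (a repeated column misses the row pattern 10), so S is shattered iff
-- {aᵢ : i ∈ S} is an edge of H(k,d). Hence the number of shattered d-sets is
-- Σ_{e ∈ E(H)} Π_{v ∈ e} c_v = n^d P(c/n), where c_v counts the columns equal to v. This gives
-- f ≤ λ n^d; equality makes the column distribution c/n of an optimal family a maximiser in (1/n)ℤ,
-- and conversely a maximiser in (1/n)ℤ is the column distribution of some family.
-- For the lower bound draw the n columns independently with distribution x: the factorial moments
-- E[Π_{v ∈ e} c_v] = n(n-1)⋯(n-|e|+1) Π_{v ∈ e} x_v of the multinomial distribution make the expected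
-- number of shattered d-sets d! C(n,d) P(x), and some draw is at least as good as the average.
module Submission where

open import Algebra.Bundles using (CommutativeSemiring; CommutativeRing)
import Algebra.Properties.CommutativeSemigroup as CommutativeSemigroupProperties
open import Data.Bool using (Bool; true; false)
import Data.Bool.Properties as Bool
open import Data.Empty using (⊥-elim)
open import Data.Fin using (Fin; zero; suc)
open import Data.Fin.Subset using (Subset; ∣_∣; _⊆_; _∩_)
open import Data.Fin.Subset.Properties using (drop-∷-⊆)
import Data.Integer as ℤ
import Data.Integer.Properties as ℤ
open import Data.List as List using (List; []; _∷_; _++_; _ʳ++_; length; filter)
import Data.List.Properties as List
open import Data.List.Membership.Propositional using (_∈_)
open import Data.List.Membership.Propositional.Properties
  using (∈-tabulate⁺; ∈-tabulate⁻; ∈-map⁺; ∈-map⁻; ∈-++⁺ˡ; ∈-++⁺ʳ; ∈-concat⁺′; ∈-concat⁻′)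
open import Data.List.Relation.Unary.All as All using (All; []; _∷_)
import Data.List.Relation.Unary.All.Properties as All
open import Data.List.Relation.Unary.Any using (here; there)
open import Data.Nat as ℕ using (ℕ; zero; suc; _≤_; _⊔_; _!; z≤n; s≤s)
import Data.Nat.Coprimality as Coprime
open import Data.Nat.Combinatorics using (_C_; nCk+nC[k+1]≡[n+1]C[k+1])
import Data.Nat.Properties as ℕ
open import Data.Nat.Tactic.RingSolver using (solve-∀)
open import Data.Product as Product using (∃; _×_; _,_; proj₁; proj₂)
open import Data.Rational as ℚ using (ℚ; 0ℚ; 1ℚ; mkℚ)
import Data.Rational.Properties as ℚ
open import Data.Sum using (_⊎_; inj₁; inj₂)
open import Data.Vec as Vec using (Vec; []; _∷_; toList; lookup; here; there)
import Data.Vec.Properties as Vec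
open import Function using (_∘_; _⇔_; mk⇔; Equivalence)
open import Relation.Binary.Definitions using (DecidableEquality)
open import Relation.Binary.PropositionalEquality
  using (_≡_; _≢_; refl; sym; trans; cong; cong₂; subst; subst₂; module ≡-Reasoning)
open import Relation.Nullary using (Dec; yes; no; ¬_)
open import Relation.Nullary.Decidable using (¬?; _×-dec_; map′)
open import Relation.Unary using (Decidable)

open import Defs

module FiniteSum {c ℓ} (R : CommutativeSemiring c ℓ) where
  open CommutativeSemiring R renaming (refl to ≈-refl; sym to ≈-sym; trans to ≈-trans)
  open CommutativeSemigroupProperties +-commutativeSemigroup using (interchange)
  open CommutativeSemigroupProperties *-commutativeSemigroup using (x∙yz≈y∙xz)

  ∑ : {Y : Set} → (Y → Carrier) → List Y → Carrier
  ∑ g ys = List.foldr _+_ 0# (List.map g ys)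

  private variable Y Z : Set

  ∑-++ : ∀ (g : Y → Carrier) xs ys → ∑ g (xs ++ ys) ≈ ∑ g xs + ∑ g ys
  ∑-++ g []       ys = ≈-sym (+-identityˡ _)
  ∑-++ g (x ∷ xs) ys = ≈-trans (+-congˡ (∑-++ g xs ys)) (≈-sym (+-assoc _ _ _))

  ∑-map : ∀ (g : Z → Carrier) (h : Y → Z) xs → ∑ g (List.map h xs) ≡ ∑ (g ∘ h) xs
  ∑-map g h xs = cong (List.foldr _+_ 0#) (sym (List.map-∘ xs))

  ∑-congᴬ : ∀ {g h : Y → Carrier} {xs} → All (λ y → g y ≈ h y) xs → ∑ g xs ≈ ∑ h xs
  ∑-congᴬ []       = ≈-refl
  ∑-congᴬ (p ∷ ps) = +-cong p (∑-congᴬ ps)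

  ∑-cong : ∀ {g h : Y → Carrier} → (∀ y → g y ≈ h y) → ∀ xs → ∑ g xs ≈ ∑ h xs
  ∑-cong g≈h xs = ∑-congᴬ (All.universal g≈h xs)

  ∑-zero : ∀ (xs : List Y) → ∑ (λ _ → 0#) xs ≈ 0#
  ∑-zero []       = ≈-refl
  ∑-zero (x ∷ xs) = ≈-trans (+-identityˡ _) (∑-zero xs)

  ∑-+ : ∀ (g h : Y → Carrier) xs → ∑ (λ y → g y + h y) xs ≈ ∑ g xs + ∑ h xs
  ∑-+ g h []       = ≈-sym (+-identityˡ 0#)
  ∑-+ g h (x ∷ xs) = ≈-trans (+-congˡ (∑-+ g h xs)) (interchange (g x) (h x) _ _)

  ∑-*ˡ : ∀ a (g : Y → Carrier) xs → ∑ (λ y → a * g y) xs ≈ a * ∑ g xs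
  ∑-*ˡ a g []       = ≈-sym (zeroʳ a)
  ∑-*ˡ a g (x ∷ xs) = ≈-trans (+-congˡ (∑-*ˡ a g xs)) (≈-sym (distribˡ a _ _))

  ∑-*-factor : ∀ a (w g : Y → Carrier) xs → ∑ (λ y → w y * (a * g y)) xs ≈ a * ∑ (λ y → w y * g y) xs
  ∑-*-factor a w g xs =
    ≈-trans (∑-cong (λ y → x∙yz≈y∙xz (w y) a (g y)) xs) (∑-*ˡ a (λ y → w y * g y) xs)

  ∑-comm : ∀ (F : Y → Z → Carrier) xs zs →
           ∑ (λ y → ∑ (F y) zs) xs ≈ ∑ (λ z → ∑ (λ y → F y z) xs) zs
  ∑-comm F []       zs = ≈-sym (∑-zero zs)
  ∑-comm F (x ∷ xs) zs =
    ≈-trans (+-congˡ (∑-comm F xs zs)) (≈-sym (∑-+ (F x) (λ z → ∑ (λ y → F y z) xs) zs))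

module ℚ* = CommutativeSemigroupProperties (CommutativeRing.*-commutativeSemigroup ℚ.+-*-commutativeRing)

module ℕΣ = FiniteSum ℕ.+-*-commutativeSemiring
module ℚΣ = FiniteSum (CommutativeRing.commutativeSemiring ℚ.+-*-commutativeRing)
open ℕΣ using () renaming (∑ to ∑ℕ)
open ℚΣ using () renaming (∑ to ∑ℚ)

𝟙 : {P : Set} → Dec P → ℕ
𝟙 (yes _) = 1
𝟙 (no _)  = 0

𝟙-cong : {P Q : Set} (p : Dec P) (q : Dec Q) → (P → Q) → (Q → P) → 𝟙 p ≡ 𝟙 q
𝟙-cong (yes _) (yes _) _   _   = refl
𝟙-cong (yes p) (no ¬q) p→q _   = ⊥-elim (¬q (p→q p))
𝟙-cong (no ¬p) (yes q) _   q→p = ⊥-elim (¬p (q→p q))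
𝟙-cong (no _)  (no _)  _   _   = refl

length-filter≡∑𝟙 : {Y : Set} {P : Y → Set} (P? : Decidable P) (xs : List Y) →
                   length (filter P? xs) ≡ ∑ℕ (𝟙 ∘ P?) xs
length-filter≡∑𝟙 P? []       = refl
length-filter≡∑𝟙 P? (x ∷ xs) with P? x
... | yes _ = cong suc (length-filter≡∑𝟙 P? xs)
... | no _  = length-filter≡∑𝟙 P? xs

∑𝟙-none : ∀ {Y : Set} {P : Y → Set} (P? : Decidable P) → (∀ y → ¬ P y) → ∀ xs → ∑ℕ (𝟙 ∘ P?) xs ≡ 0
∑𝟙-none P? ¬P xs = trans (ℕΣ.∑-cong 𝟙≡0 xs) (ℕΣ.∑-zero xs)
  where
  𝟙≡0 : ∀ y → 𝟙 (P? y) ≡ 0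
  𝟙≡0 y with P? y
  ... | yes p = ⊥-elim (¬P y p)
  ... | no _  = refl

∑𝟙-mono : ∀ {Y : Set} {P Q : Y → Set} (P? : Decidable P) (Q? : Decidable Q) → (∀ y → P y → Q y) →
          ∀ xs → ∑ℕ (𝟙 ∘ P?) xs ≤ ∑ℕ (𝟙 ∘ Q?) xs
∑𝟙-mono P? Q? P⇒Q []       = z≤n
∑𝟙-mono {P = P} {Q} P? Q? P⇒Q (x ∷ xs) = ℕ.+-mono-≤ (𝟙-mono (P? x) (Q? x)) (∑𝟙-mono P? Q? P⇒Q xs)
  where
  𝟙-mono : ∀ (p : Dec (P x)) (q : Dec (Q x)) → 𝟙 p ≤ 𝟙 q
  𝟙-mono (yes p) (yes _) = ℕ.≤-refl
  𝟙-mono (yes p) (no ¬q) = ⊥-elim (¬q (P⇒Q x p))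
  𝟙-mono (no _)  _       = z≤n

module Occurrences {X : Set} (_≟_ : DecidableEquality X) where

  δ : X → X → ℕ
  δ u v = 𝟙 (u ≟ v)

  occ : List X → X → ℕ
  occ L v = ∑ℕ (λ u → δ u v) L

  occProd : ∀ {d} → List X → Vec X d → ℕ
  occProd L []      = 1
  occProd L (u ∷ e) = occ L u ℕ.* occProd L e

  without : X → List X → List X
  without v = filter (λ u → ¬? (u ≟ v))

  δ-refl : ∀ u → δ u u ≡ 1
  δ-refl u with u ≟ u
  ... | yes _  = refl
  ... | no u≢u = ⊥-elim (u≢u refl)

  δ-≢ : ∀ {u v} → u ≢ v → δ u v ≡ 0
  δ-≢ {u} {v} u≢v with u ≟ v
  ... | yes u≡v = ⊥-elim (u≢v u≡v)
  ... | no _    = refl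

  δ-sym : ∀ u v → δ u v ≡ δ v u
  δ-sym u v = 𝟙-cong (u ≟ v) (v ≟ u) sym sym

  occ-++ : ∀ xs ys v → occ (xs ++ ys) v ≡ occ xs v ℕ.+ occ ys v
  occ-++ xs ys v = ℕΣ.∑-++ (λ u → δ u v) xs ys

  occ-without-self : ∀ v L → occ (without v L) v ≡ 0
  occ-without-self v []      = refl
  occ-without-self v (u ∷ L) with u ≟ v
  ... | yes _   = occ-without-self v L
  ... | no u≢v  = cong₂ ℕ._+_ (δ-≢ u≢v) (occ-without-self v L)

  occ-without-≢ : ∀ {u v} → u ≢ v → ∀ L → occ (without v L) u ≡ occ L u
  occ-without-≢ u≢v []      = refl
  occ-without-≢ {u} {v} u≢v (w ∷ L) with w ≟ v
  ... | yes refl = cong₂ ℕ._+_ (sym (δ-≢ (u≢v ∘ sym))) (occ-without-≢ u≢v L)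
  ... | no _     = cong (δ w u ℕ.+_) (occ-without-≢ u≢v L)

  occProd-without : ∀ {d} v L (e : Vec X d) → occ (toList e) v ≡ 0 →
                    occProd (without v L) e ≡ occProd L e
  occProd-without v L []      _  = refl
  occProd-without v L (u ∷ e) v∉ = cong₂ ℕ._*_ (occ-without-≢ u≢v L)
                                     (occProd-without v L e (ℕ.m+n≡0⇒n≡0 (δ u v) v∉))
    where
    u≢v : u ≢ v
    u≢v refl = ℕ.1+n≢0 (trans (cong (ℕ._+ occ (toList e) u) (sym (δ-refl u))) v∉)

  occ-combinations : ∀ d xs →
    All (λ (e : Vec X d) → ∀ u → occ (toList e) u ≤ occ xs u) (combinations d xs)
  occ-combinations zero    xs       = (λ _ → z≤n) ∷ []
  occ-combinations (suc d) []       = []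
  occ-combinations (suc d) (x ∷ xs) = All.++⁺
    (All.map⁺ (All.map (λ sub u → ℕ.+-monoʳ-≤ (δ x u) (sub u)) (occ-combinations d xs)))
    (All.map (λ sub u → ℕ.m≤n⇒m≤o+n (δ x u) (sub u)) (occ-combinations (suc d) xs))

  occ-replicate : ∀ c v u → occ (List.replicate c v) u ≡ c ℕ.* δ v u
  occ-replicate zero    v u = refl
  occ-replicate (suc c) v u = cong (δ v u ℕ.+_) (occ-replicate c v u)

  occ-concatMap : ∀ {Y : Set} (g : Y → List X) ys u → occ (List.concatMap g ys) u ≡ ∑ℕ (λ y → occ (g y) u) ys
  occ-concatMap g []       u = refl
  occ-concatMap g (y ∷ ys) u = trans (occ-++ (g y) _ u) (cong (occ (g y) u ℕ.+_) (occ-concatMap g ys u))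

  ∑-sift : ∀ (g : X → ℕ) L u → ∑ℕ (λ v → g v ℕ.* δ v u) L ≡ occ L u ℕ.* g u
  ∑-sift g []      u = refl
  ∑-sift g (v ∷ L) u = trans (cong₂ ℕ._+_ gδ≡δg (∑-sift g L u)) (sym (ℕ.*-distribʳ-+ (g u) (δ v u) (occ L u)))
    where
    gδ≡δg : g v ℕ.* δ v u ≡ δ v u ℕ.* g u
    gδ≡δg with v ≟ u
    ... | yes refl = ℕ.*-comm (g v) 1
    ... | no _     = ℕ.*-zeroʳ (g v)

  picks : ∀ {m} → Vec X (suc m) → List (X × Vec X m)
  picks {zero}  (u ∷ [])    = (u , []) ∷ []
  picks {suc m} (u ∷ e)     = (u , e) ∷ List.map (Product.map₂ (u ∷_)) (picks e)

  length-picks : ∀ {m} (e : Vec X (suc m)) → length (picks e) ≡ suc m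
  length-picks {zero}  (u ∷ []) = refl
  length-picks {suc m} (u ∷ e)  = cong suc (trans (List.length-map _ (picks e)) (length-picks e))

  occ-picks : ∀ {m} (e : Vec X (suc m)) →
              All (λ (w , r) → ∀ u → occ (toList r) u ≤ occ (toList e) u) (picks e)
  occ-picks {zero}  (u ∷ [])  = (λ _ → z≤n) ∷ []
  occ-picks {suc m} (u ∷ e)   = (λ w → ℕ.m≤n+m (occ (toList e) w) (δ u w))
    ∷ All.map⁺ (All.map (λ sub w → ℕ.+-monoʳ-≤ (δ u w) (sub w)) (occ-picks e))

  module _ (v : X) (L : List X) where
    open import Data.Nat.Base using (_+_; _*_)

    occProdHead : ∀ {m} → Vec X (suc m) → ℕ
    occProdHead e = ∑ℕ (λ (w , r) → δ v w * occProd L r) (picks e)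

    occProdHead-∷ : ∀ {m} u (e : Vec X (suc m)) →
      occProdHead (u ∷ e) ≡ δ v u * occProd L e + occ L u * occProdHead e
    occProdHead-∷ u e = cong (δ v u * occProd L e +_) (begin
      ∑ℕ (λ (w , r) → δ v w * occProd L r) (List.map (Product.map₂ (u ∷_)) (picks e))
        ≡⟨ ℕΣ.∑-map (λ (w , r) → δ v w * occProd L r) (Product.map₂ (u ∷_)) (picks e) ⟩
      ∑ℕ (λ (w , r) → δ v w * (occ L u * occProd L r)) (picks e)
        ≡⟨ ℕΣ.∑-*-factor (occ L u) (λ (w , r) → δ v w) (λ (w , r) → occProd L r) (picks e) ⟩
      occ L u * occProdHead e ∎)
      where open ≡-Reasoning

    occProdHead-absent : ∀ {m} (e : Vec X (suc m)) → occ (toList e) v ≡ 0 → occProdHead e ≡ 0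
    occProdHead-absent {zero}  (u ∷ []) v∉ = cong (_+ 0) (cong (_* 1) (trans (δ-sym v u) (ℕ.m+n≡0⇒m≡0 (δ u v) v∉)))
    occProdHead-absent {suc m} (u ∷ e)  v∉ = begin
      occProdHead (u ∷ e)                              ≡⟨ occProdHead-∷ u e ⟩
      δ v u * occProd L e + occ L u * occProdHead e
        ≡⟨ cong₂ (λ a b → a * occProd L e + occ L u * b) (trans (δ-sym v u) (ℕ.m+n≡0⇒m≡0 (δ u v) v∉))
                                                          (occProdHead-absent e (ℕ.m+n≡0⇒n≡0 (δ u v) v∉)) ⟩
      occ L u * 0                                         ≡⟨ ℕ.*-zeroʳ (occ L u) ⟩
      0                                                   ∎
      where open ≡-Reasoning

    -- Expand Π_{u ∈ e} (δ v u + occ L u): as e has no repeated entry, at most one factor contributes δ.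
    occProd-∷ : ∀ {m} (e : Vec X (suc m)) → (∀ u → occ (toList e) u ≤ 1) →
                occProd (v ∷ L) e ≡ occProd L e + occProdHead e
    occProd-∷ {zero}  (u ∷ []) _ = rearrange (δ v u) (occ L u)
      where
      rearrange : ∀ a b → (a + b) * 1 ≡ b * 1 + (a * 1 + 0)
      rearrange = solve-∀
    occProd-∷ {suc m} (u ∷ e) distinct = begin
      (δ v u + occ L u) * occProd (v ∷ L) e
        ≡⟨ cong ((δ v u + occ L u) *_) (occProd-∷ e (λ w → ℕ.≤-trans (ℕ.m≤n+m _ (δ u w)) (distinct w))) ⟩
      (δ v u + occ L u) * (occProd L e + occProdHead e)
        ≡⟨ expand (δ v u) (occ L u) (occProd L e) (occProdHead e) ⟩
      occ L u * occProd L e + (δ v u * occProd L e + occ L u * occProdHead e) + δ v u * occProdHead e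
        ≡⟨ cong₂ (λ a b → occ L u * occProd L e + a + b) (sym (occProdHead-∷ u e)) δW≡0 ⟩
      occ L u * occProd L e + occProdHead (u ∷ e) + 0
        ≡⟨ ℕ.+-identityʳ _ ⟩
      occ L u * occProd L e + occProdHead (u ∷ e) ∎
      where
      open ≡-Reasoning
      expand : ∀ a b c d → (a + b) * (c + d) ≡ b * c + (a * c + b * d) + a * d
      expand = solve-∀
      δW≡0 : δ v u * occProdHead e ≡ 0
      δW≡0 with v ≟ u
      ... | no _     = refl
      ... | yes refl = trans (ℕ.+-identityʳ _) (occProdHead-absent e
                         (ℕ.n≤0⇒n≡0 (ℕ.≤-pred (subst (_≤ 1) (cong (_+ occ (toList e) v) (δ-refl v)) (distinct v)))))

∑-allVecs-suc : ∀ {n} (g : Vec Bool (suc n) → ℕ) →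
  ∑ℕ g (allVecs (suc n)) ≡ ∑ℕ (g ∘ (true ∷_)) (allVecs n) ℕ.+ ∑ℕ (g ∘ (false ∷_)) (allVecs n)
∑-allVecs-suc {n} g = begin
  ∑ℕ g (List.map (true ∷_) (allVecs n) ++ List.map (false ∷_) (allVecs n))
    ≡⟨ ℕΣ.∑-++ g (List.map (true ∷_) (allVecs n)) _ ⟩
  ∑ℕ g (List.map (true ∷_) (allVecs n)) ℕ.+ ∑ℕ g (List.map (false ∷_) (allVecs n))
    ≡⟨ cong₂ ℕ._+_ (ℕΣ.∑-map g (true ∷_) (allVecs n)) (ℕΣ.∑-map g (false ∷_) (allVecs n)) ⟩
  ∑ℕ (g ∘ (true ∷_)) (allVecs n) ℕ.+ ∑ℕ (g ∘ (false ∷_)) (allVecs n) ∎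
  where open ≡-Reasoning

∑-combinations-suc : ∀ {X : Set} {d} (g : Vec X (suc d) → ℕ) x xs →
  ∑ℕ g (combinations (suc d) (x ∷ xs))
    ≡ ∑ℕ (g ∘ (x ∷_)) (combinations d xs) ℕ.+ ∑ℕ g (combinations (suc d) xs)
∑-combinations-suc {d = d} g x xs =
  trans (ℕΣ.∑-++ g (List.map (x ∷_) (combinations d xs)) _)
        (cong (ℕ._+ _) (ℕΣ.∑-map g (x ∷_) (combinations d xs)))

select : ∀ {X : Set} {n} → Subset n → Vec X n → List X
select []          []      = []
select (true ∷ A)  (x ∷ a) = x ∷ select A a
select (false ∷ A) (x ∷ a) = select A a

∑-subsets≡∑-combinations : ∀ {X : Set} {Q : List X → Set} (Q? : Decidable Q) {n} (a : Vec X n) d →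
  ∑ℕ (λ A → 𝟙 ((∣ A ∣ ℕ.≟ d) ×-dec Q? (select A a))) (allVecs n)
    ≡ ∑ℕ (λ σ → 𝟙 (Q? (toList σ))) (combinations d (toList a))
∑-subsets≡∑-combinations Q? []      zero    with Q? []
... | yes _ = refl
... | no _  = refl
∑-subsets≡∑-combinations Q? []      (suc d) = refl
∑-subsets≡∑-combinations Q? {suc n} (x ∷ a) zero    = begin
  ∑ℕ (λ A → 𝟙 ((∣ A ∣ ℕ.≟ 0) ×-dec Q? (select A (x ∷ a)))) (allVecs (suc n))
    ≡⟨ ∑-allVecs-suc (λ A → 𝟙 ((∣ A ∣ ℕ.≟ 0) ×-dec Q? (select A (x ∷ a)))) ⟩
  ∑ℕ (λ A → 𝟙 ((suc ∣ A ∣ ℕ.≟ 0) ×-dec Q? (x ∷ select A a))) (allVecs n) ℕ.+ _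
    ≡⟨ cong (ℕ._+ ∑ℕ (λ A → 𝟙 ((∣ A ∣ ℕ.≟ 0) ×-dec Q? (select A a))) (allVecs n))
            (∑𝟙-none (λ A → (suc ∣ A ∣ ℕ.≟ 0) ×-dec Q? (x ∷ select A a))
                     (λ _ → ℕ.1+n≢0 ∘ proj₁) (allVecs n)) ⟩
  ∑ℕ (λ A → 𝟙 ((∣ A ∣ ℕ.≟ 0) ×-dec Q? (select A a))) (allVecs n)
    ≡⟨ ∑-subsets≡∑-combinations Q? a zero ⟩
  _ ∎
  where open ≡-Reasoning
∑-subsets≡∑-combinations Q? {suc n} (x ∷ a) (suc d) = begin
  ∑ℕ (λ A → 𝟙 ((∣ A ∣ ℕ.≟ suc d) ×-dec Q? (select A (x ∷ a)))) (allVecs (suc n))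
    ≡⟨ ∑-allVecs-suc (λ A → 𝟙 ((∣ A ∣ ℕ.≟ suc d) ×-dec Q? (select A (x ∷ a)))) ⟩
  ∑ℕ (λ A → 𝟙 ((suc ∣ A ∣ ℕ.≟ suc d) ×-dec Q? (x ∷ select A a))) (allVecs n) ℕ.+
  ∑ℕ (λ A → 𝟙 ((∣ A ∣ ℕ.≟ suc d) ×-dec Q? (select A a))) (allVecs n)
    ≡⟨ cong₂ ℕ._+_ (trans (ℕΣ.∑-cong (λ A → 𝟙-cong ((suc ∣ A ∣ ℕ.≟ suc d) ×-dec Q? (x ∷ select A a))
                                                     ((∣ A ∣ ℕ.≟ d) ×-dec Q? (x ∷ select A a))
                                                     (λ (e , q) → ℕ.suc-injective e , q)
                                                     (λ (e , q) → cong suc e , q)) (allVecs n))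
                          (∑-subsets≡∑-combinations (Q? ∘ (x ∷_)) a d))
                   (∑-subsets≡∑-combinations Q? a (suc d)) ⟩
  ∑ℕ (λ σ → 𝟙 (Q? (x ∷ toList σ))) (combinations d (toList a)) ℕ.+
  ∑ℕ (λ σ → 𝟙 (Q? (toList σ))) (combinations (suc d) (toList a))
    ≡⟨ sym (∑-combinations-suc (λ σ → 𝟙 (Q? (toList σ))) x (toList a)) ⟩
  ∑ℕ (λ σ → 𝟙 (Q? (toList σ))) (combinations (suc d) (x ∷ toList a)) ∎
  where open ≡-Reasoning

length-select : ∀ {X : Set} {n} (A : Subset n) (a : Vec X n) → length (select A a) ≡ ∣ A ∣
length-select []          []      = refl
length-select (true ∷ A)  (x ∷ a) = cong suc (length-select A a)
length-select (false ∷ A) (x ∷ a) = length-select A a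

select-map : ∀ {X Y : Set} {n} (g : X → Y) (A : Subset n) (a : Vec X n) →
             List.map g (select A a) ≡ select A (Vec.map g a)
select-map g []          []      = refl
select-map g (true ∷ A)  (x ∷ a) = cong (g x ∷_) (select-map g A a)
select-map g (false ∷ A) (x ∷ a) = select-map g A a

select-∩ : ∀ {n} (A F : Subset n) → select A (F ∩ A) ≡ select A F
select-∩ []          []      = refl
select-∩ (true ∷ A)  (b ∷ F) = cong₂ _∷_ (Bool.∧-identityʳ b) (select-∩ A F)
select-∩ (false ∷ A) (b ∷ F) = select-∩ A F

select-injective : ∀ {n} (A A′ F : Subset n) → A′ ⊆ A → select A F ≡ select A A′ → F ∩ A ≡ A′
select-injective []          []          []      _  _  = refl
select-injective (true ∷ A)  (b′ ∷ A′)   (b ∷ F) ⊆A eq = cong₂ _∷_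
  (trans (Bool.∧-identityʳ b) (List.∷-injectiveˡ eq)) (select-injective A A′ F (drop-∷-⊆ ⊆A) (List.∷-injectiveʳ eq))
select-injective (false ∷ A) (true ∷ A′) (b ∷ F) ⊆A eq with ⊆A here
... | ()
select-injective (false ∷ A) (false ∷ A′) (b ∷ F) ⊆A eq =
  cong₂ _∷_ (Bool.∧-zeroʳ b) (select-injective A A′ F (drop-∷-⊆ ⊆A) eq)

unselect : ∀ {n} → Subset n → List Bool → Subset n
unselect []          _       = []
unselect (true ∷ A)  []      = false ∷ unselect A []
unselect (true ∷ A)  (b ∷ B) = b ∷ unselect A B
unselect (false ∷ A) B       = false ∷ unselect A B

select-unselect : ∀ {n} (A : Subset n) B → length B ≡ ∣ A ∣ → select A (unselect A B) ≡ B
select-unselect []          []      _ = refl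
select-unselect (true ∷ A)  (b ∷ B) l = cong (b ∷_) (select-unselect A B (ℕ.suc-injective l))
select-unselect (false ∷ A) B       l = select-unselect A B l

unselect-⊆ : ∀ {n} (A : Subset n) B → unselect A B ⊆ A
unselect-⊆ (true ∷ A)  []      (there i∈) = there (unselect-⊆ A [] i∈)
unselect-⊆ (true ∷ A)  (b ∷ B) here       = here
unselect-⊆ (true ∷ A)  (b ∷ B) (there i∈) = there (unselect-⊆ A B i∈)
unselect-⊆ (false ∷ A) B       (there i∈) = there (unselect-⊆ A B i∈)

module MultisetCombinations
  {X : Set} (_≟_ : DecidableEquality X) {Q : List X → Set} (Q? : Decidable Q)
  (Q-swap : ∀ p u w σ → Q (p ++ u ∷ w ∷ σ) → Q (p ++ w ∷ u ∷ σ))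
  (Q-dup : ∀ p u σ → ¬ Q (p ++ u ∷ u ∷ σ))
  where

  open import Data.Nat.Base using (_+_; _*_)
  open Occurrences _≟_
  open ≡-Reasoning

  private
    Q-swapʳ : ∀ τ u w σ → Q (τ ʳ++ u ∷ w ∷ σ) → Q (τ ʳ++ w ∷ u ∷ σ)
    Q-swapʳ τ u w σ q = subst Q (sym (List.ʳ++-defn τ))
                          (Q-swap (List.reverse τ) u w σ (subst Q (List.ʳ++-defn τ) q))

    Q-dupʳ : ∀ τ u σ → ¬ Q (τ ʳ++ u ∷ u ∷ σ)
    Q-dupʳ τ u σ = Q-dup (List.reverse τ) u σ ∘ subst Q (List.ʳ++-defn τ)

  -- The prefix τ is kept reversed, so that choosing one more element is a cons.
  completions : List X → ℕ → List X → ℕ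
  completions τ d L = ∑ℕ (λ σ → 𝟙 (Q? (τ ʳ++ toList σ))) (combinations d L)

  completions-∷ : ∀ τ d x L →
    completions τ (suc d) (x ∷ L) ≡ completions (x ∷ τ) d L + completions τ (suc d) L
  completions-∷ τ d x L = ∑-combinations-suc (λ σ → 𝟙 (Q? (τ ʳ++ toList σ))) x L

  completions-dup : ∀ τ x d L → completions (x ∷ x ∷ τ) d L ≡ 0
  completions-dup τ x d L =
    ∑𝟙-none (λ σ → Q? ((x ∷ x ∷ τ) ʳ++ toList σ)) (λ σ → Q-dupʳ τ x (toList σ)) (combinations d L)

  completions-swap : ∀ τ u w d L → completions (u ∷ w ∷ τ) d L ≡ completions (w ∷ u ∷ τ) d L
  completions-swap τ u w d L = ℕΣ.∑-cong
    (λ σ → 𝟙-cong (Q? ((u ∷ w ∷ τ) ʳ++ toList σ)) (Q? ((w ∷ u ∷ τ) ʳ++ toList σ))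
                  (Q-swapʳ τ w u (toList σ)) (Q-swapʳ τ u w (toList σ)))
    (combinations d L)

  mutual
    -- A (d+1)-combination of L avoids v or uses exactly one of its copies (two copies violate Q-dup).
    completions-split : ∀ v τ d L →
      completions τ (suc d) L
        ≡ occ L v * completions (v ∷ τ) d (without v L) + completions τ (suc d) (without v L)
    completions-split v τ d []      = refl
    completions-split v τ d (x ∷ L) with x ≟ v
    ... | yes refl = begin
      completions τ (suc d) (x ∷ L)
        ≡⟨ completions-∷ τ d x L ⟩
      completions (x ∷ τ) d L + completions τ (suc d) L
        ≡⟨ cong₂ _+_ (completions-without-self x τ d L) (completions-split x τ d L) ⟩
      completions (x ∷ τ) d M + (occ L x * completions (x ∷ τ) d M + completions τ (suc d) M)
        ≡⟨ ℕ.+-assoc (completions (x ∷ τ) d M) _ _ ⟨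
      suc (occ L x) * completions (x ∷ τ) d M + completions τ (suc d) M ∎
      where M = without x L
    ... | no x≢v = begin
      completions τ (suc d) (x ∷ L)
        ≡⟨ completions-∷ τ d x L ⟩
      completions (x ∷ τ) d L + completions τ (suc d) L
        ≡⟨ cong (completions (x ∷ τ) d L +_) (completions-split v τ d L) ⟩
      completions (x ∷ τ) d L + (o * completions (v ∷ τ) d M + r)
        ≡⟨ ℕ.+-assoc (completions (x ∷ τ) d L) _ r ⟨
      completions (x ∷ τ) d L + o * completions (v ∷ τ) d M + r
        ≡⟨ cong (_+ r) (exchange d) ⟩
      o * completions (v ∷ τ) d (x ∷ M) + completions (x ∷ τ) d M + r
        ≡⟨ ℕ.+-assoc (o * completions (v ∷ τ) d (x ∷ M)) _ r ⟩
      o * completions (v ∷ τ) d (x ∷ M) + (completions (x ∷ τ) d M + r)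
        ≡⟨ cong (o * completions (v ∷ τ) d (x ∷ M) +_) (completions-∷ τ d x M) ⟨
      o * completions (v ∷ τ) d (x ∷ M) + completions τ (suc d) (x ∷ M) ∎
      where
      M = without v L
      o = occ L v
      r = completions τ (suc d) M
      rearrange : ∀ o s a b → o * s + a + o * b ≡ o * (s + b) + a
      rearrange = solve-∀
      exchange : ∀ d → completions (x ∷ τ) d L + o * completions (v ∷ τ) d M
                         ≡ o * completions (v ∷ τ) d (x ∷ M) + completions (x ∷ τ) d M
      exchange zero    = ℕ.+-comm (completions (x ∷ τ) zero L) _
      exchange (suc d) = begin
        completions (x ∷ τ) (suc d) L + o * completions (v ∷ τ) (suc d) M
          ≡⟨ cong (_+ o * completions (v ∷ τ) (suc d) M) (completions-split v (x ∷ τ) d L) ⟩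
        o * completions (v ∷ x ∷ τ) d M + completions (x ∷ τ) (suc d) M + o * completions (v ∷ τ) (suc d) M
          ≡⟨ cong (λ s → o * s + completions (x ∷ τ) (suc d) M + o * completions (v ∷ τ) (suc d) M)
                  (completions-swap τ v x d M) ⟩
        o * completions (x ∷ v ∷ τ) d M + completions (x ∷ τ) (suc d) M + o * completions (v ∷ τ) (suc d) M
          ≡⟨ rearrange o _ _ _ ⟩
        o * (completions (x ∷ v ∷ τ) d M + completions (v ∷ τ) (suc d) M) + completions (x ∷ τ) (suc d) M
          ≡⟨ cong (λ c → o * c + completions (x ∷ τ) (suc d) M) (sym (completions-∷ (v ∷ τ) d x M)) ⟩
        o * completions (v ∷ τ) (suc d) (x ∷ M) + completions (x ∷ τ) (suc d) M ∎

    completions-without-self : ∀ v τ d L → completions (v ∷ τ) d L ≡ completions (v ∷ τ) d (without v L)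
    completions-without-self v τ zero    L = refl
    completions-without-self v τ (suc d) L = begin
      completions (v ∷ τ) (suc d) L
        ≡⟨ completions-split v (v ∷ τ) d L ⟩
      occ L v * completions (v ∷ v ∷ τ) d (without v L) + completions (v ∷ τ) (suc d) (without v L)
        ≡⟨ cong (λ c → occ L v * c + completions (v ∷ τ) (suc d) (without v L))
                (completions-dup τ v d (without v L)) ⟩
      occ L v * 0 + completions (v ∷ τ) (suc d) (without v L)
        ≡⟨ cong (_+ completions (v ∷ τ) (suc d) (without v L)) (ℕ.*-zeroʳ (occ L v)) ⟩
      completions (v ∷ τ) (suc d) (without v L) ∎

  weighted : List X → (d : ℕ) → List X → List X → ℕ
  weighted τ d V L = ∑ℕ (λ e → 𝟙 (Q? (τ ʳ++ toList e)) * occProd L e) (combinations d V)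

  weighted-without : ∀ v τ d V L → occ V v ≡ 0 → weighted τ d V (without v L) ≡ weighted τ d V L
  weighted-without v τ d V L v∉V = ℕΣ.∑-congᴬ
    (All.map (λ {e} e⊆V → cong (𝟙 (Q? (τ ʳ++ toList e)) *_)
                                (occProd-without v L e (ℕ.n≤0⇒n≡0 (subst (_ ≤_) v∉V (e⊆V v)))))
             (occ-combinations d V))

  weighted-∷ : ∀ τ d v V L →
    weighted τ (suc d) (v ∷ V) L ≡ occ L v * weighted (v ∷ τ) d V L + weighted τ (suc d) V L
  weighted-∷ τ d v V L = begin
    weighted τ (suc d) (v ∷ V) L
      ≡⟨ ∑-combinations-suc (λ e → 𝟙 (Q? (τ ʳ++ toList e)) * occProd L e) v V ⟩
    ∑ℕ (λ e → 𝟙 (Q? ((v ∷ τ) ʳ++ toList e)) * (occ L v * occProd L e)) (combinations d V)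
      + weighted τ (suc d) V L
      ≡⟨ cong (_+ weighted τ (suc d) V L)
              (ℕΣ.∑-*-factor (occ L v) (λ e → 𝟙 (Q? ((v ∷ τ) ʳ++ toList e))) (occProd L) (combinations d V)) ⟩
    occ L v * weighted (v ∷ τ) d V L + weighted τ (suc d) V L ∎

  completions≡weighted : ∀ V L → (∀ u → occ V u ≤ 1) → (∀ u → occ V u ≡ 0 → occ L u ≡ 0) →
                         ∀ τ d → completions τ d L ≡ weighted τ d V L
  completions≡weighted V       L       _   _    τ zero    = cong (_+ 0) (sym (ℕ.*-identityʳ _))
  completions≡weighted []      []      _   _    τ (suc d) = refl
  completions≡weighted []      (x ∷ L) _   L⊆[] τ (suc d) =
    ⊥-elim (ℕ.1+n≢0 (trans (cong (_+ occ L x) (sym (δ-refl x))) (L⊆[] x refl)))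
  completions≡weighted (v ∷ V) L       ≤1  L⊆V  τ (suc d) = begin
    completions τ (suc d) L
      ≡⟨ completions-split v τ d L ⟩
    occ L v * completions (v ∷ τ) d M + completions τ (suc d) M
      ≡⟨ cong₂ (λ a b → occ L v * a + b) (completions≡weighted V M ≤1′ M⊆V (v ∷ τ) d)
                                          (completions≡weighted V M ≤1′ M⊆V τ (suc d)) ⟩
    occ L v * weighted (v ∷ τ) d V M + weighted τ (suc d) V M
      ≡⟨ cong₂ (λ a b → occ L v * a + b) (weighted-without v (v ∷ τ) d V L v∉V)
                                          (weighted-without v τ (suc d) V L v∉V) ⟩
    occ L v * weighted (v ∷ τ) d V L + weighted τ (suc d) V L
      ≡⟨ sym (weighted-∷ τ d v V L) ⟩
    weighted τ (suc d) (v ∷ V) L ∎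
    where
    M = without v L
    ≤1′ : ∀ u → occ V u ≤ 1
    ≤1′ u = ℕ.≤-trans (ℕ.m≤n+m (occ V u) (δ v u)) (≤1 u)
    v∉V : occ V v ≡ 0
    v∉V = ℕ.n≤0⇒n≡0 (ℕ.≤-pred (subst (_≤ 1) (cong (_+ occ V v) (δ-refl v)) (≤1 v)))
    M⊆V : ∀ u → occ V u ≡ 0 → occ M u ≡ 0
    M⊆V u u∉V with u ≟ v
    ... | yes refl = occ-without-self u L
    ... | no u≢v   = trans (occ-without-≢ u≢v L) (L⊆V u (trans (cong (_+ occ V u) (δ-≢ (u≢v ∘ sym))) u∉V))

  ∑-combinations≡∑-by-multiplicity : ∀ V → (∀ u → occ V u ≡ 1) → ∀ L d →
    ∑ℕ (λ σ → 𝟙 (Q? (toList σ))) (combinations d L)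
      ≡ ∑ℕ (λ e → 𝟙 (Q? (toList e)) * occProd L e) (combinations d V)
  ∑-combinations≡∑-by-multiplicity V V≡1 L d =
    completions≡weighted V L (ℕ.≤-reflexive ∘ V≡1) (λ u V≡0 → ⊥-elim (ℕ.1+n≢0 (trans (sym (V≡1 u)) V≡0))) [] d

swapAt : {A : Set} → ℕ → List A → List A
swapAt zero    (a ∷ b ∷ r) = b ∷ a ∷ r
swapAt zero    r           = r
swapAt (suc n) []          = []
swapAt (suc n) (a ∷ r)     = a ∷ swapAt n r

module _ {A : Set} where

  swapAt-involutive : ∀ n (l : List A) → swapAt n (swapAt n l) ≡ l
  swapAt-involutive zero    []          = refl
  swapAt-involutive zero    (a ∷ [])    = refl
  swapAt-involutive zero    (a ∷ b ∷ r) = refl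
  swapAt-involutive (suc n) []          = refl
  swapAt-involutive (suc n) (a ∷ r)     = cong (a ∷_) (swapAt-involutive n r)

  length-swapAt : ∀ n (l : List A) → length (swapAt n l) ≡ length l
  length-swapAt zero    []          = refl
  length-swapAt zero    (a ∷ [])    = refl
  length-swapAt zero    (a ∷ b ∷ r) = refl
  length-swapAt (suc n) []          = refl
  length-swapAt (suc n) (a ∷ r)     = cong suc (length-swapAt n r)

  map-swapAt : ∀ {B : Set} (g : A → B) n l → List.map g (swapAt n l) ≡ swapAt n (List.map g l)
  map-swapAt g zero    []          = refl
  map-swapAt g zero    (a ∷ [])    = refl
  map-swapAt g zero    (a ∷ b ∷ r) = refl
  map-swapAt g (suc n) []          = refl
  map-swapAt g (suc n) (a ∷ r)     = cong (g a ∷_) (map-swapAt g n r)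

  swapAt-++ : ∀ (p : List A) a b r → swapAt (length p) (p ++ a ∷ b ∷ r) ≡ p ++ b ∷ a ∷ r
  swapAt-++ []      a b r = refl
  swapAt-++ (x ∷ p) a b r = cong (x ∷_) (swapAt-++ p a b r)

  ++-cancelˡ-length : ∀ (xs ys : List A) {r r′} → length xs ≡ length ys → xs ++ r ≡ ys ++ r′ → r ≡ r′
  ++-cancelˡ-length []       []       _  eq = eq
  ++-cancelˡ-length (x ∷ xs) (y ∷ ys) ∣≡∣ eq =
    ++-cancelˡ-length xs ys (ℕ.suc-injective ∣≡∣) (List.∷-injectiveʳ eq)

rowOf : ∀ {k} → List (Vec Bool k) → Fin k → List Bool
rowOf L j = List.map (λ c → lookup c j) L

Shattered : ∀ {k} → List (Vec Bool k) → Set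
Shattered {k} L = ∀ B → length B ≡ length L → ∃ λ (j : Fin k) → rowOf L j ≡ B

module _ {k : ℕ} where

  rowOf-toList : ∀ {m} (M : Vec (Vec Bool k) m) j → rowOf (toList M) j ≡ toList (row M j)
  rowOf-toList M j = sym (Vec.toList-map (λ c → lookup c j) M)

  MatShattered⇒Shattered : ∀ {m} (M : Vec (Vec Bool k) m) → MatShattered M → Shattered (toList M)
  MatShattered⇒Shattered M sh B ∣B∣ = j , (begin
    rowOf (toList M) j        ≡⟨ rowOf-toList M j ⟩
    toList (row M j)          ≡⟨ cong toList row≡ ⟩
    toList (Vec.cast _ (Vec.fromList B)) ≡⟨ Vec.toList-cast _ (Vec.fromList B) ⟩
    toList (Vec.fromList B)   ≡⟨ Vec.toList∘fromList B ⟩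
    B                         ∎)
    where
    open ≡-Reasoning
    w = Vec.cast (trans ∣B∣ (Vec.length-toList M)) (Vec.fromList B)
    j = proj₁ (sh w)
    row≡ = proj₂ (sh w)

  Shattered⇒MatShattered : ∀ {m} (M : Vec (Vec Bool k) m) → Shattered (toList M) → MatShattered M
  Shattered⇒MatShattered M sh w with sh (toList w) (trans (Vec.length-toList w) (sym (Vec.length-toList M)))
  ... | j , row≡ = j , trans (sym (Vec.cast-is-id refl (row M j)))
                              (Vec.toList-injective refl (row M j) w (trans (sym (rowOf-toList M j)) row≡))

  shattered? : Decidable (Shattered {k})
  shattered? L = map′ (subst Shattered (Vec.toList∘fromList L) ∘ MatShattered⇒Shattered (Vec.fromList L))
                      (Shattered⇒MatShattered (Vec.fromList L) ∘ subst Shattered (sym (Vec.toList∘fromList L)))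
                      (matShattered? (Vec.fromList L))

  Shattered-swapAt : ∀ n (L : List (Vec Bool k)) → Shattered L → Shattered (swapAt n L)
  Shattered-swapAt n L sh B ∣B∣ with sh (swapAt n B) (trans (length-swapAt n B) (trans ∣B∣ (length-swapAt n L)))
  ... | j , row≡ = j , (begin
    rowOf (swapAt n L) j            ≡⟨ map-swapAt (λ c → lookup c j) n L ⟩
    swapAt n (rowOf L j)            ≡⟨ cong (swapAt n) row≡ ⟩
    swapAt n (swapAt n B)           ≡⟨ swapAt-involutive n B ⟩
    B                               ∎)
    where open ≡-Reasoning

  Shattered-swap : ∀ (p : List (Vec Bool k)) u w σ → Shattered (p ++ u ∷ w ∷ σ) → Shattered (p ++ w ∷ u ∷ σ)
  Shattered-swap p u w σ = subst (Shattered {k}) (swapAt-++ p u w σ) ∘ Shattered-swapAt (length p) (p ++ u ∷ w ∷ σ)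

  -- A repeated column u can never carry the row pattern (true , false) at its two positions.
  Shattered-dup : ∀ (p : List (Vec Bool k)) u σ → ¬ Shattered (p ++ u ∷ u ∷ σ)
  Shattered-dup p u σ sh = no-row (proj₁ (sh B ∣B∣≡∣L∣)) (proj₂ (sh B ∣B∣≡∣L∣))
    where
    open ≡-Reasoning
    falses : List (Vec Bool k) → List Bool
    falses = List.map (λ _ → false)

    B : List Bool
    B = falses p ++ true ∷ false ∷ falses σ

    ∣B∣≡∣L∣ : length B ≡ length (p ++ u ∷ u ∷ σ)
    ∣B∣≡∣L∣ = begin
      length B                                      ≡⟨ List.length-++ (falses p) ⟩
      length (falses p) ℕ.+ suc (suc (length (falses σ)))
        ≡⟨ cong₂ (λ a b → a ℕ.+ suc (suc b)) (List.length-map _ p) (List.length-map _ σ) ⟩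
      length p ℕ.+ suc (suc (length σ))            ≡⟨ List.length-++ p ⟨
      length (p ++ u ∷ u ∷ σ)                       ∎

    no-row : ∀ j → rowOf (p ++ u ∷ u ∷ σ) j ≢ B
    no-row j row≡ with trans (sym (List.∷-injectiveˡ entries)) (List.∷-injectiveˡ (List.∷-injectiveʳ entries))
      where
      entries : lookup u j ∷ lookup u j ∷ rowOf σ j ≡ true ∷ false ∷ falses σ
      entries = ++-cancelˡ-length (rowOf p j) (falses p) (trans (List.length-map _ p) (sym (List.length-map _ p)))
                  (trans (sym (List.map-++ (λ c → lookup c j) p (u ∷ u ∷ σ))) row≡)
    ... | ()

_≟ᵛ_ : ∀ {k} → DecidableEquality (Vec Bool k)
_≟ᵛ_ = Vec.≡-dec Bool._≟_

module VecOccurrences {k : ℕ} = Occurrences (_≟ᵛ_ {k})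
open VecOccurrences

occ-map-∷ : ∀ {k} b (L : List (Vec Bool k)) w → occ (List.map (b ∷_) L) (b ∷ w) ≡ occ L w
occ-map-∷ b L w = trans (ℕΣ.∑-map (λ u → δ u (b ∷ w)) (b ∷_) L)
                        (ℕΣ.∑-cong (λ x → 𝟙-cong ((b ∷ x) ≟ᵛ (b ∷ w)) (x ≟ᵛ w) Vec.∷-injectiveʳ (cong (b ∷_))) L)

occ-map-∷-≢ : ∀ {k b b′} → b ≢ b′ → ∀ (L : List (Vec Bool k)) w → occ (List.map (b ∷_) L) (b′ ∷ w) ≡ 0
occ-map-∷-≢ {b = b} {b′} b≢b′ L w = trans (ℕΣ.∑-map (λ u → δ u (b′ ∷ w)) (b ∷_) L)
  (∑𝟙-none (λ x → (b ∷ x) ≟ᵛ (b′ ∷ w)) (λ _ → b≢b′ ∘ Vec.∷-injectiveˡ) L)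

occ-allVecs : ∀ k (u : Vec Bool k) → occ (allVecs k) u ≡ 1
occ-allVecs zero    []          = refl
occ-allVecs (suc k) (true ∷ w)  = begin
  occ (allVecs (suc k)) (true ∷ w)
    ≡⟨ occ-++ (List.map (true ∷_) (allVecs k)) _ (true ∷ w) ⟩
  occ (List.map (true ∷_) (allVecs k)) (true ∷ w) ℕ.+ occ (List.map (false ∷_) (allVecs k)) (true ∷ w)
    ≡⟨ cong₂ ℕ._+_ (trans (occ-map-∷ true (allVecs k) w) (occ-allVecs k w)) (occ-map-∷-≢ (λ ()) (allVecs k) w) ⟩
  1 ∎
  where open ≡-Reasoning
occ-allVecs (suc k) (false ∷ w) = begin
  occ (allVecs (suc k)) (false ∷ w)
    ≡⟨ occ-++ (List.map (true ∷_) (allVecs k)) _ (false ∷ w) ⟩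
  occ (List.map (true ∷_) (allVecs k)) (false ∷ w) ℕ.+ occ (List.map (false ∷_) (allVecs k)) (false ∷ w)
    ≡⟨ cong₂ ℕ._+_ (occ-map-∷-≢ (λ ()) (allVecs k) w) (trans (occ-map-∷ false (allVecs k) w) (occ-allVecs k w)) ⟩
  1 ∎
  where open ≡-Reasoning

famOf : ∀ {k n} → Vec (Vec Bool k) n → Family n
famOf a = List.tabulate (row a)

Shatters-famOf⇔Shattered : ∀ {k n} (a : Vec (Vec Bool k) n) A → Shatters (famOf a) A ⇔ Shattered (select A a)
Shatters-famOf⇔Shattered {k} a A = mk⇔ to from
  where
  rowOf-select : ∀ j → rowOf (select A a) j ≡ select A (row a j)
  rowOf-select j = select-map (λ c → lookup c j) A a

  to : Shatters (famOf a) A → Shattered (select A a)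
  to sh B ∣B∣ with sh (unselect A B) (unselect-⊆ A B)
  ... | F , F∈ , F∩A≡ with ∈-tabulate⁻ F∈
  ... | j , refl = j , (begin
    rowOf (select A a) j           ≡⟨ rowOf-select j ⟩
    select A (row a j)             ≡⟨ select-∩ A (row a j) ⟨
    select A (row a j ∩ A)         ≡⟨ cong (select A) F∩A≡ ⟩
    select A (unselect A B)        ≡⟨ select-unselect A B (trans ∣B∣ (length-select A a)) ⟩
    B                              ∎)
    where open ≡-Reasoning

  from : Shattered (select A a) → Shatters (famOf a) A
  from sh A′ A′⊆A with sh (select A A′) (trans (length-select A A′) (sym (length-select A a)))
  ... | j , row≡ = row a j , ∈-tabulate⁺ j , select-injective A A′ (row a j) A′⊆A (trans (sym (rowOf-select j)) row≡)

∑-occ : ∀ {k} (L : List (Vec Bool k)) → ∑ℕ (occ L) (allVecs k) ≡ length L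
∑-occ {k} []      = ℕΣ.∑-zero (allVecs k)
∑-occ {k} (u ∷ L) = begin
  ∑ℕ (λ v → δ u v ℕ.+ occ L v) (allVecs k)        ≡⟨ ℕΣ.∑-+ (δ u) (occ L) (allVecs k) ⟩
  ∑ℕ (δ u) (allVecs k) ℕ.+ ∑ℕ (occ L) (allVecs k) ≡⟨ cong₂ ℕ._+_ (trans (ℕΣ.∑-cong (δ-sym u) (allVecs k)) (occ-allVecs k u)) (∑-occ L) ⟩
  suc (length L)                                  ∎
  where open ≡-Reasoning

vertexSets : (k d : ℕ) → List (Vec (Vec Bool k) d)
vertexSets k d = combinations d (allVecs k)

edgeCopies : ∀ {k} d → List (Vec Bool k) → ℕ
edgeCopies {k} d L = ∑ℕ (λ e → 𝟙 (matShattered? e) ℕ.* occProd L e) (vertexSets k d)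

numShattered-famOf : ∀ {k n} d (a : Vec (Vec Bool k) n) → numShattered d (famOf a) ≡ edgeCopies d (toList a)
numShattered-famOf {k} {n} d a = begin
  numShattered d (famOf a)
    ≡⟨ length-filter≡∑𝟙 (λ A → (∣ A ∣ ℕ.≟ d) ×-dec shatters? (famOf a) A) (allVecs n) ⟩
  ∑ℕ (λ A → 𝟙 ((∣ A ∣ ℕ.≟ d) ×-dec shatters? (famOf a) A)) (allVecs n)
    ≡⟨ ℕΣ.∑-cong (λ A → 𝟙-cong ((∣ A ∣ ℕ.≟ d) ×-dec shatters? (famOf a) A)
                               ((∣ A ∣ ℕ.≟ d) ×-dec shattered? (select A a))
                               (Product.map₂ (Equivalence.to (Shatters-famOf⇔Shattered a A)))
                               (Product.map₂ (Equivalence.from (Shatters-famOf⇔Shattered a A))))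
                 (allVecs n) ⟩
  ∑ℕ (λ A → 𝟙 ((∣ A ∣ ℕ.≟ d) ×-dec shattered? (select A a))) (allVecs n)
    ≡⟨ ∑-subsets≡∑-combinations shattered? a d ⟩
  ∑ℕ (λ σ → 𝟙 (shattered? (toList σ))) (combinations d (toList a))
    ≡⟨ ∑-combinations≡∑-by-multiplicity (allVecs k) (occ-allVecs k) (toList a) d ⟩
  ∑ℕ (λ e → 𝟙 (shattered? (toList e)) ℕ.* occProd (toList a) e) (combinations d (allVecs k))
    ≡⟨ ℕΣ.∑-cong (λ e → cong (ℕ._* occProd (toList a) e)
                              (𝟙-cong (shattered? (toList e)) (matShattered? e)
                                      (Shattered⇒MatShattered e) (MatShattered⇒Shattered e)))
                 (combinations d (allVecs k)) ⟩
  edgeCopies d (toList a) ∎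
  where
  open ≡-Reasoning
  open MultisetCombinations _≟ᵛ_ shattered? Shattered-swap Shattered-dup

ℕ→ℚ≡mkℚ : ∀ m → ℕ→ℚ m ≡ mkℚ (ℤ.+ m) 0 (Coprime.sym (Coprime.1-coprimeTo m))
ℕ→ℚ≡mkℚ m = ℚ.normalize-coprime (Coprime.sym (Coprime.1-coprimeTo m))

ℕ→ℚ-+ : ∀ a b → ℕ→ℚ (a ℕ.+ b) ≡ ℕ→ℚ a ℚ.+ ℕ→ℚ b
ℕ→ℚ-+ a b rewrite ℕ→ℚ≡mkℚ a | ℕ→ℚ≡mkℚ b =
  sym (cong₂ (λ x y → (x ℤ.+ y) ℚ./ 1) (ℤ.*-identityʳ (ℤ.+ a)) (ℤ.*-identityʳ (ℤ.+ b)))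

ℕ→ℚ-* : ∀ a b → ℕ→ℚ (a ℕ.* b) ≡ ℕ→ℚ a ℚ.* ℕ→ℚ b
ℕ→ℚ-* a b rewrite ℕ→ℚ≡mkℚ a | ℕ→ℚ≡mkℚ b = sym (cong (ℚ._/ 1) (ℤ.+◃n≡+n (a ℕ.* b)))

ℕ→ℚ-mono-≤ : ∀ {a b} → a ≤ b → ℕ→ℚ a ℚ.≤ ℕ→ℚ b
ℕ→ℚ-mono-≤ {a} {b} a≤b rewrite ℕ→ℚ≡mkℚ a | ℕ→ℚ≡mkℚ b =
  ℚ.*≤* (subst₂ ℤ._≤_ (sym (ℤ.*-identityʳ (ℤ.+ a))) (sym (ℤ.*-identityʳ (ℤ.+ b))) (ℤ.+≤+ a≤b))

ℕ→ℚ-injective : ∀ {a b} → ℕ→ℚ a ≡ ℕ→ℚ b → a ≡ b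
ℕ→ℚ-injective {a} {b} eq rewrite ℕ→ℚ≡mkℚ a | ℕ→ℚ≡mkℚ b = ℤ.+-injective (cong ℚ.↥_ eq)

ℕ→ℚ-nonNeg : ∀ a → 0ℚ ℚ.≤ ℕ→ℚ a
ℕ→ℚ-nonNeg a = ℕ→ℚ-mono-≤ {0} {a} z≤n

ℕ→ℚ-pos : ∀ {a} → 0 ℕ.< a → 0ℚ ℚ.< ℕ→ℚ a
ℕ→ℚ-pos {suc a} _ rewrite ℕ→ℚ≡mkℚ (suc a) = ℚ.*<* (ℤ.+<+ (s≤s z≤n))

ℕ→ℚ-∑ : ∀ {Y : Set} (g : Y → ℕ) xs → ℕ→ℚ (∑ℕ g xs) ≡ ∑ℚ (ℕ→ℚ ∘ g) xs
ℕ→ℚ-∑ g []       = refl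
ℕ→ℚ-∑ g (x ∷ xs) = trans (ℕ→ℚ-+ (g x) _) (cong (ℕ→ℚ (g x) ℚ.+_) (ℕ→ℚ-∑ g xs))

∑ℚ-filter : ∀ {Y : Set} {P : Y → Set} (P? : Decidable P) (g : Y → ℚ) xs →
            ∑ℚ g (filter P? xs) ≡ ∑ℚ (λ y → ℕ→ℚ (𝟙 (P? y)) ℚ.* g y) xs
∑ℚ-filter P? g []       = refl
∑ℚ-filter P? g (x ∷ xs) with P? x
... | yes _ = cong₂ ℚ._+_ (sym (ℚ.*-identityˡ (g x))) (∑ℚ-filter P? g xs)
... | no _  = trans (∑ℚ-filter P? g xs)
                    (sym (trans (cong (ℚ._+ _) (ℚ.*-zeroˡ (g x))) (ℚ.+-identityˡ _)))

∑ℚ-mono : ∀ {Y : Set} {g h : Y → ℚ} → (∀ y → g y ℚ.≤ h y) → ∀ xs → ∑ℚ g xs ℚ.≤ ∑ℚ h xs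
∑ℚ-mono g≤h []       = ℚ.≤-refl
∑ℚ-mono g≤h (x ∷ xs) = ℚ.+-mono-≤ (g≤h x) (∑ℚ-mono g≤h xs)

∑ℚ-const : ∀ {Y : Set} c (xs : List Y) → ∑ℚ (λ _ → c) xs ≡ ℕ→ℚ (length xs) ℚ.* c
∑ℚ-const c []       = sym (ℚ.*-zeroˡ c)
∑ℚ-const c (y ∷ ys) = begin
  c ℚ.+ ∑ℚ (λ _ → c) ys                   ≡⟨ cong₂ ℚ._+_ (sym (ℚ.*-identityˡ c)) (∑ℚ-const c ys) ⟩
  1ℚ ℚ.* c ℚ.+ ℕ→ℚ (length ys) ℚ.* c     ≡⟨ ℚ.*-distribʳ-+ c 1ℚ (ℕ→ℚ (length ys)) ⟨
  (1ℚ ℚ.+ ℕ→ℚ (length ys)) ℚ.* c         ≡⟨ cong (ℚ._* c) (ℕ→ℚ-+ 1 (length ys)) ⟨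
  ℕ→ℚ (suc (length ys)) ℚ.* c            ∎
  where open ≡-Reasoning

module _ {k : ℕ} (d : ℕ) where

  P≡∑vertexSets : ∀ x → P k d x ≡ ∑ℚ (λ e → ℕ→ℚ (𝟙 (matShattered? e)) ℚ.* prodℚ (Vec.map x e)) (vertexSets k d)
  P≡∑vertexSets x = ∑ℚ-filter matShattered? (λ e → prodℚ (Vec.map x e)) (vertexSets k d)

  P-cong : ∀ {x y : Point k} → (∀ v → x v ≡ y v) → P k d x ≡ P k d y
  P-cong x≡y = ℚΣ.∑-cong (λ e → cong prodℚ (Vec.map-cong x≡y e)) (filter matShattered? (vertexSets k d))

  edgeCopies≡P : ∀ L → ℕ→ℚ (edgeCopies d L) ≡ P k d (ℕ→ℚ ∘ occ L)
  edgeCopies≡P L = begin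
    ℕ→ℚ (edgeCopies d L)
      ≡⟨ ℕ→ℚ-∑ (λ e → 𝟙 (matShattered? e) ℕ.* occProd L e) (vertexSets k d) ⟩
    ∑ℚ (λ e → ℕ→ℚ (𝟙 (matShattered? e) ℕ.* occProd L e)) (vertexSets k d)
      ≡⟨ ℚΣ.∑-cong (λ e → trans (ℕ→ℚ-* (𝟙 (matShattered? e)) _) (cong (ℕ→ℚ (𝟙 (matShattered? e)) ℚ.*_) (ℕ→ℚ-occProd e))) (vertexSets k d) ⟩
    ∑ℚ (λ e → ℕ→ℚ (𝟙 (matShattered? e)) ℚ.* prodℚ (Vec.map (ℕ→ℚ ∘ occ L) e)) (vertexSets k d)
      ≡⟨ P≡∑vertexSets (ℕ→ℚ ∘ occ L) ⟨
    P k d (ℕ→ℚ ∘ occ L) ∎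
    where
    open ≡-Reasoning
    ℕ→ℚ-occProd : ∀ {m} (e : Vec (Vec Bool k) m) → ℕ→ℚ (occProd L e) ≡ prodℚ (Vec.map (ℕ→ℚ ∘ occ L) e)
    ℕ→ℚ-occProd []      = refl
    ℕ→ℚ-occProd (u ∷ e) = trans (ℕ→ℚ-* (occ L u) _) (cong (ℕ→ℚ (occ L u) ℚ.*_) (ℕ→ℚ-occProd e))

  P-homogeneous : ∀ c (y : Point k) → P k d (λ v → ℕ→ℚ c ℚ.* y v) ≡ ℕ→ℚ (c ℕ.^ d) ℚ.* P k d y
  P-homogeneous c y = trans (ℚΣ.∑-cong prodℚ-scale (filter matShattered? (vertexSets k d)))
                            (ℚΣ.∑-*ˡ (ℕ→ℚ (c ℕ.^ d)) (λ e → prodℚ (Vec.map y e)) (filter matShattered? (vertexSets k d)))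
    where
    prodℚ-scale : ∀ {m} (e : Vec (Vec Bool k) m) →
                  prodℚ (Vec.map (λ v → ℕ→ℚ c ℚ.* y v) e) ≡ ℕ→ℚ (c ℕ.^ m) ℚ.* prodℚ (Vec.map y e)
    prodℚ-scale []      = sym (ℚ.*-identityˡ 1ℚ)
    prodℚ-scale {suc m} (u ∷ e) = begin
      (ℕ→ℚ c ℚ.* y u) ℚ.* prodℚ (Vec.map (λ v → ℕ→ℚ c ℚ.* y v) e)  ≡⟨ cong ((ℕ→ℚ c ℚ.* y u) ℚ.*_) (prodℚ-scale e) ⟩
      (ℕ→ℚ c ℚ.* y u) ℚ.* (ℕ→ℚ (c ℕ.^ m) ℚ.* prodℚ (Vec.map y e))  ≡⟨ ℚ*.interchange (ℕ→ℚ c) (y u) _ _ ⟩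
      (ℕ→ℚ c ℚ.* ℕ→ℚ (c ℕ.^ m)) ℚ.* (y u ℚ.* prodℚ (Vec.map y e))  ≡⟨ cong (ℚ._* _) (ℕ→ℚ-* c (c ℕ.^ m)) ⟨
      ℕ→ℚ (c ℕ.^ suc m) ℚ.* prodℚ (Vec.map y (u ∷ e))              ∎
      where open ≡-Reasoning

numShattered≡P : ∀ {k n} d (a : Vec (Vec Bool k) n) (y : Point k) →
  (∀ v → ℕ→ℚ n ℚ.* y v ≡ ℕ→ℚ (occ (toList a) v)) →
  ℕ→ℚ (numShattered d (famOf a)) ≡ ℕ→ℚ (n ℕ.^ d) ℚ.* P k d y
numShattered≡P {k} {n} d a y n*y≡occ = begin
  ℕ→ℚ (numShattered d (famOf a))        ≡⟨ cong ℕ→ℚ (numShattered-famOf d a) ⟩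
  ℕ→ℚ (edgeCopies d (toList a))         ≡⟨ edgeCopies≡P d (toList a) ⟩
  P k d (ℕ→ℚ ∘ occ (toList a))          ≡⟨ P-cong d (sym ∘ n*y≡occ) ⟩
  P k d (λ v → ℕ→ℚ n ℚ.* y v)           ≡⟨ P-homogeneous d n y ⟩
  ℕ→ℚ (n ℕ.^ d) ℚ.* P k d y             ∎
  where open ≡-Reasoning

module _ {A : Set} where

  foldr-⊔-upper : ∀ (g : A → ℕ) {xs y} → y ∈ xs → g y ≤ List.foldr _⊔_ 0 (List.map g xs)
  foldr-⊔-upper g {x ∷ xs} (here refl) = ℕ.m≤m⊔n (g x) _
  foldr-⊔-upper g {x ∷ xs} (there y∈)  = ℕ.≤-trans (foldr-⊔-upper g y∈) (ℕ.m≤n⊔m (g x) _)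

  foldr-⊔-attained : ∀ (g : A → ℕ) xs →
    List.foldr _⊔_ 0 (List.map g xs) ≡ 0 ⊎ ∃ λ y → y ∈ xs × List.foldr _⊔_ 0 (List.map g xs) ≡ g y
  foldr-⊔-attained g []       = inj₁ refl
  foldr-⊔-attained g (x ∷ xs) with ℕ.⊔-sel (g x) (List.foldr _⊔_ 0 (List.map g xs))
  ... | inj₁ max≡gx = inj₂ (x , here refl , max≡gx)
  ... | inj₂ max≡rest with foldr-⊔-attained g xs
  ...   | inj₁ rest≡0           = inj₁ (trans max≡rest rest≡0)
  ...   | inj₂ (y , y∈ , rest≡) = inj₂ (y , there y∈ , trans max≡rest rest≡)

  listsUpTo-complete : ∀ m (xs l : List A) → length l ≤ m → All (_∈ xs) l → l ∈ listsUpTo m xs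
  listsUpTo-complete zero    xs []      _         _          = here refl
  listsUpTo-complete (suc m) xs []      _         _          = here refl
  listsUpTo-complete (suc m) xs (y ∷ l) (s≤s ∣l∣) (y∈ ∷ l⊆) =
    there (∈-concat⁺′ (∈-map⁺ (y ∷_) (listsUpTo-complete m xs l ∣l∣ l⊆))
                      (∈-map⁺ (λ a → List.map (a ∷_) (listsUpTo m xs)) y∈))

  listsUpTo-length : ∀ m (xs l : List A) → l ∈ listsUpTo m xs → length l ≤ m
  listsUpTo-length zero    xs l (here refl) = z≤n
  listsUpTo-length (suc m) xs l (here refl) = z≤n
  listsUpTo-length (suc m) xs l (there l∈)
    with ∈-concat⁻′ (List.map (λ a → List.map (a ∷_) (listsUpTo m xs)) xs) l∈
  ... | ys , l∈ys , ys∈ with ∈-map⁻ (λ a → List.map (a ∷_) (listsUpTo m xs)) ys∈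
  ... | a , _ , refl with ∈-map⁻ (a ∷_) l∈ys
  ... | l′ , l′∈ , refl = s≤s (listsUpTo-length m xs l′ l′∈)

  lookup-padRight : ∀ {k} (a : A) (xs : List A) (∣xs∣≤k : length xs ≤ k) {x} → x ∈ xs →
                    ∃ λ j → lookup (Vec.padRight ∣xs∣≤k a (Vec.fromList xs)) j ≡ x
  lookup-padRight a (x ∷ xs) (s≤s ∣xs∣≤k) (here refl) = zero , refl
  lookup-padRight a (x ∷ xs) (s≤s ∣xs∣≤k) (there x∈) with lookup-padRight a xs ∣xs∣≤k x∈
  ... | j , lookup≡ = suc j , lookup≡

allVecs-complete : ∀ {n} (A : Vec Bool n) → A ∈ allVecs n
allVecs-complete []          = here refl
allVecs-complete (true ∷ A)  = ∈-++⁺ˡ (∈-map⁺ (true ∷_) (allVecs-complete A))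
allVecs-complete (false ∷ A) = ∈-++⁺ʳ _ (∈-map⁺ (false ∷_) (allVecs-complete A))

numShattered-mono : ∀ {n} d (ℱ 𝒢 : Family n) → (∀ {F} → F ∈ ℱ → F ∈ 𝒢) → numShattered d ℱ ≤ numShattered d 𝒢
numShattered-mono {n} d ℱ 𝒢 ℱ⊆𝒢 = subst₂ _≤_
  (sym (length-filter≡∑𝟙 (λ A → (∣ A ∣ ℕ.≟ d) ×-dec shatters? ℱ A) (allVecs n)))
  (sym (length-filter≡∑𝟙 (λ A → (∣ A ∣ ℕ.≟ d) ×-dec shatters? 𝒢 A) (allVecs n)))
  (∑𝟙-mono _ _ (λ A → Product.map₂ (λ sh A′ A′⊆A → Product.map₂ (Product.map₁ ℱ⊆𝒢) (sh A′ A′⊆A))) (allVecs n))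

columns : ∀ {k n} → Vec (Subset n) k → Vec (Vec Bool k) n
columns rows = Vec.tabulate (λ i → Vec.map (λ F → lookup F i) rows)

row-columns : ∀ {k n} (rows : Vec (Subset n) k) j → row (columns rows) j ≡ lookup rows j
row-columns rows j = begin
  Vec.map (λ c → lookup c j) (Vec.tabulate (λ i → Vec.map (λ F → lookup F i) rows))
    ≡⟨ Vec.tabulate-∘ (λ c → lookup c j) _ ⟨
  Vec.tabulate (λ i → lookup (Vec.map (λ F → lookup F i) rows) j)
    ≡⟨ Vec.tabulate-cong (λ i → Vec.lookup-map j (λ F → lookup F i) rows) ⟩
  Vec.tabulate (λ i → lookup (lookup rows j) i)
    ≡⟨ Vec.tabulate∘lookup (lookup rows j) ⟩
  lookup rows j ∎
  where open ≡-Reasoning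

module _ {k : ℕ} where

  f-upper : ∀ {n} d (a : Vec (Vec Bool k) n) → numShattered d (famOf a) ≤ f n k d
  f-upper {n} d a = foldr-⊔-upper (numShattered d)
    (listsUpTo-complete k (allVecs n) (famOf a) (ℕ.≤-reflexive (List.length-tabulate (row a)))
                        (All.universal allVecs-complete (famOf a)))

  -- The maximum defining f is attained by a list of at most k sets; padding it to k rows gives an
  -- assignment whose family contains every set of the list.
  f-attained : ∀ n d → ∃ λ (a : Vec (Vec Bool k) n) → numShattered d (famOf a) ≡ f n k d
  f-attained n d with foldr-⊔-attained (numShattered d) (listsUpTo k (allVecs n))
  ... | inj₁ f≡0 = a₀ , trans (ℕ.n≤0⇒n≡0 (ℕ.≤-trans (f-upper d a₀) (ℕ.≤-reflexive f≡0))) (sym f≡0)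
    where a₀ = Vec.replicate n (Vec.replicate k false)
  ... | inj₂ (ℱ , ℱ∈ , f≡) = a , ℕ.≤-antisym (f-upper d a)
      (subst (_≤ numShattered d (famOf a)) (sym f≡) (numShattered-mono d ℱ (famOf a) ℱ⊆famOf))
    where
    ∣ℱ∣≤k = listsUpTo-length k (allVecs n) ℱ ℱ∈
    rows  = Vec.padRight ∣ℱ∣≤k (Vec.replicate n false) (Vec.fromList ℱ)
    a     = columns rows
    ℱ⊆famOf : ∀ {F} → F ∈ ℱ → F ∈ famOf a
    ℱ⊆famOf F∈ with lookup-padRight (Vec.replicate n false) ℱ ∣ℱ∣≤k F∈
    ... | j , refl = subst (_∈ famOf a) (row-columns rows j) (∈-tabulate⁺ j)

falling : ℕ → ℕ → ℕ
falling n m = m ! ℕ.* (n C m)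

falling-0-suc : ∀ m → falling 0 (suc m) ≡ 0
falling-0-suc m = ℕ.*-zeroʳ (suc m !)

falling-suc : ∀ n m → falling (suc n) (suc m) ≡ falling n (suc m) ℕ.+ suc m ℕ.* falling n m
falling-suc n m = trans (cong (suc m ! ℕ.*_) (sym (nCk+nC[k+1]≡[n+1]C[k+1] n m)))
                        (rearrange (suc m) (m !) (n C m) (n C suc m))
  where
  open import Data.Nat.Base using (_+_; _*_)
  rearrange : ∀ a b c d → (a * b) * (c + d) ≡ (a * b) * d + a * (b * c)
  rearrange = solve-∀

module Expectation {k : ℕ} (x : Point k) where
  open import Data.Rational.Base using (_+_; _*_)

  𝔼 : ∀ n → (Vec (Vec Bool k) n → ℚ) → ℚ
  𝔼 zero    g = g []
  𝔼 (suc n) g = ∑ℚ (λ v → x v * 𝔼 n (g ∘ (v ∷_))) (allVecs k)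

  𝔼-cong : ∀ n {g h : Vec (Vec Bool k) n → ℚ} → (∀ a → g a ≡ h a) → 𝔼 n g ≡ 𝔼 n h
  𝔼-cong zero    g≡h = g≡h []
  𝔼-cong (suc n) g≡h = ℚΣ.∑-cong (λ v → cong (x v *_) (𝔼-cong n (g≡h ∘ (v ∷_)))) (allVecs k)

  𝔼-zero : ∀ n → 𝔼 n (λ _ → 0ℚ) ≡ 0ℚ
  𝔼-zero zero    = refl
  𝔼-zero (suc n) = trans (ℚΣ.∑-cong (λ v → trans (cong (x v *_) (𝔼-zero n)) (ℚ.*-zeroʳ (x v))) (allVecs k))
                         (ℚΣ.∑-zero (allVecs k))

  𝔼-+ : ∀ n (g h : Vec (Vec Bool k) n → ℚ) → 𝔼 n (λ a → g a + h a) ≡ 𝔼 n g + 𝔼 n h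
  𝔼-+ zero    g h = refl
  𝔼-+ (suc n) g h = trans
    (ℚΣ.∑-cong (λ v → trans (cong (x v *_) (𝔼-+ n (g ∘ (v ∷_)) (h ∘ (v ∷_)))) (ℚ.*-distribˡ-+ (x v) _ _)) (allVecs k))
    (ℚΣ.∑-+ (λ v → x v * 𝔼 n (g ∘ (v ∷_))) (λ v → x v * 𝔼 n (h ∘ (v ∷_))) (allVecs k))

  𝔼-*ˡ : ∀ n c (g : Vec (Vec Bool k) n → ℚ) → 𝔼 n (λ a → c * g a) ≡ c * 𝔼 n g
  𝔼-*ˡ zero    c g = refl
  𝔼-*ˡ (suc n) c g = trans
    (ℚΣ.∑-cong (λ v → trans (cong (x v *_) (𝔼-*ˡ n c (g ∘ (v ∷_)))) (ℚ*.x∙yz≈y∙xz (x v) c _)) (allVecs k))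
    (ℚΣ.∑-*ˡ c (λ v → x v * 𝔼 n (g ∘ (v ∷_))) (allVecs k))

  𝔼-∑ : ∀ {Y : Set} n (G : Y → Vec (Vec Bool k) n → ℚ) ys →
        𝔼 n (λ a → ∑ℚ (λ y → G y a) ys) ≡ ∑ℚ (λ y → 𝔼 n (G y)) ys
  𝔼-∑ n G []       = 𝔼-zero n
  𝔼-∑ n G (y ∷ ys) = trans (𝔼-+ n (G y) (λ a → ∑ℚ (λ y → G y a) ys)) (cong (𝔼 n (G y) +_) (𝔼-∑ n G ys))

  prodℚ-picks : ∀ {m} (e : Vec (Vec Bool k) (suc m)) →
    All (λ (w , r) → x w * prodℚ (Vec.map x r) ≡ prodℚ (Vec.map x e)) (picks e)
  prodℚ-picks {zero}  (u ∷ []) = refl ∷ []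
  prodℚ-picks {suc m} (u ∷ e)  = refl ∷ All.map⁺ (All.map
    (λ {(w , r)} eq → trans (ℚ*.x∙yz≈y∙xz (x w) (x u) _) (cong (x u *_) eq)) (prodℚ-picks e))

  module Simplex (x∈Δ : InSimplex x) where
    open ≡-Reasoning

    ∑x* : ∀ c → ∑ℚ (λ v → x v * c) (allVecs k) ≡ c
    ∑x* c = begin
      ∑ℚ (λ v → x v * c) (allVecs k) ≡⟨ ℚΣ.∑-cong (λ v → ℚ.*-comm (x v) c) (allVecs k) ⟩
      ∑ℚ (λ v → c * x v) (allVecs k) ≡⟨ ℚΣ.∑-*ˡ c x (allVecs k) ⟩
      c * ∑ℚ x (allVecs k)           ≡⟨ cong (c *_) (proj₂ x∈Δ) ⟩
      c * 1ℚ                         ≡⟨ ℚ.*-identityʳ c ⟩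
      c                              ∎

    ∑xδ : ∀ w → ∑ℚ (λ v → x v * ℕ→ℚ (δ v w)) (allVecs k) ≡ x w
    ∑xδ w = trans (∑xδ-list (allVecs k)) (trans (cong (λ o → ℕ→ℚ o * x w) (occ-allVecs k w)) (ℚ.*-identityˡ (x w)))
      where
      xδ≡δx : ∀ v → x v * ℕ→ℚ (δ v w) ≡ ℕ→ℚ (δ v w) * x w
      xδ≡δx v with v ≟ᵛ w
      ... | yes refl = ℚ.*-comm (x v) 1ℚ
      ... | no _     = trans (ℚ.*-zeroʳ (x v)) (sym (ℚ.*-zeroˡ (x w)))
      ∑xδ-list : ∀ L → ∑ℚ (λ v → x v * ℕ→ℚ (δ v w)) L ≡ ℕ→ℚ (occ L w) * x w
      ∑xδ-list []      = sym (ℚ.*-zeroˡ (x w))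
      ∑xδ-list (v ∷ L) = begin
        x v * ℕ→ℚ (δ v w) + ∑ℚ (λ v → x v * ℕ→ℚ (δ v w)) L   ≡⟨ cong₂ _+_ (xδ≡δx v) (∑xδ-list L) ⟩
        ℕ→ℚ (δ v w) * x w + ℕ→ℚ (occ L w) * x w             ≡⟨ ℚ.*-distribʳ-+ (x w) (ℕ→ℚ (δ v w)) (ℕ→ℚ (occ L w)) ⟨
        (ℕ→ℚ (δ v w) + ℕ→ℚ (occ L w)) * x w                 ≡⟨ cong (_* x w) (ℕ→ℚ-+ (δ v w) (occ L w)) ⟨
        ℕ→ℚ (occ (v ∷ L) w) * x w                           ∎

    𝔼-const : ∀ n c → 𝔼 n (λ _ → c) ≡ c
    𝔼-const zero    c = refl
    𝔼-const (suc n) c = trans (ℚΣ.∑-cong (λ v → cong (x v *_) (𝔼-const n c)) (allVecs k)) (∑x* c)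

    𝔼-≤ : ∀ n {g : Vec (Vec Bool k) n → ℚ} {c} → (∀ a → g a ℚ.≤ c) → 𝔼 n g ℚ.≤ c
    𝔼-≤ zero    g≤c = g≤c []
    𝔼-≤ (suc n) {c = c} g≤c = ℚ.≤-trans
      (∑ℚ-mono (λ v → ℚ.*-monoˡ-≤-nonNeg (x v) {{ℚ.nonNegative (proj₁ x∈Δ v)}} (𝔼-≤ n (g≤c ∘ (v ∷_)))) (allVecs k))
      (ℚ.≤-reflexive (∑x* c))

    ∑x-mixture : ∀ {Y : Set} A (ps : List Y) (w : Y → Vec Bool k) (B : Y → ℚ) →
      ∑ℚ (λ v → x v * (A + ∑ℚ (λ p → ℕ→ℚ (δ v (w p)) * B p) ps)) (allVecs k) ≡ A + ∑ℚ (λ p → x (w p) * B p) ps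
    ∑x-mixture A ps w B = begin
      ∑ℚ (λ v → x v * (A + ∑ℚ (λ p → ℕ→ℚ (δ v (w p)) * B p) ps)) (allVecs k)
        ≡⟨ ℚΣ.∑-cong (λ v → ℚ.*-distribˡ-+ (x v) A _) (allVecs k) ⟩
      ∑ℚ (λ v → x v * A + x v * ∑ℚ (λ p → ℕ→ℚ (δ v (w p)) * B p) ps) (allVecs k)
        ≡⟨ ℚΣ.∑-+ (λ v → x v * A) _ (allVecs k) ⟩
      ∑ℚ (λ v → x v * A) (allVecs k) + ∑ℚ (λ v → x v * ∑ℚ (λ p → ℕ→ℚ (δ v (w p)) * B p) ps) (allVecs k)
        ≡⟨ cong₂ _+_ (∑x* A) (ℚΣ.∑-cong (λ v → sym (ℚΣ.∑-*ˡ (x v) _ ps)) (allVecs k)) ⟩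
      A + ∑ℚ (λ v → ∑ℚ (λ p → x v * (ℕ→ℚ (δ v (w p)) * B p)) ps) (allVecs k)
        ≡⟨ cong (A +_) (ℚΣ.∑-comm (λ v p → x v * (ℕ→ℚ (δ v (w p)) * B p)) (allVecs k) ps) ⟩
      A + ∑ℚ (λ p → ∑ℚ (λ v → x v * (ℕ→ℚ (δ v (w p)) * B p)) (allVecs k)) ps
        ≡⟨ cong (A +_) (ℚΣ.∑-cong (λ p → select-w p) ps) ⟩
      A + ∑ℚ (λ p → x (w p) * B p) ps ∎
      where
      select-w : ∀ p → ∑ℚ (λ v → x v * (ℕ→ℚ (δ v (w p)) * B p)) (allVecs k) ≡ x (w p) * B p
      select-w p = begin
        ∑ℚ (λ v → x v * (ℕ→ℚ (δ v (w p)) * B p)) (allVecs k)  ≡⟨ ℚΣ.∑-cong (λ v → ℚ.*-assoc (x v) _ (B p)) (allVecs k) ⟨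
        ∑ℚ (λ v → x v * ℕ→ℚ (δ v (w p)) * B p) (allVecs k)    ≡⟨ ℚΣ.∑-cong (λ v → ℚ.*-comm _ (B p)) (allVecs k) ⟩
        ∑ℚ (λ v → B p * (x v * ℕ→ℚ (δ v (w p)))) (allVecs k)  ≡⟨ ℚΣ.∑-*ˡ (B p) _ (allVecs k) ⟩
        B p * ∑ℚ (λ v → x v * ℕ→ℚ (δ v (w p))) (allVecs k)    ≡⟨ cong (B p *_) (∑xδ (w p)) ⟩
        B p * x (w p)                                          ≡⟨ ℚ.*-comm (B p) (x (w p)) ⟩
        x (w p) * B p                                          ∎

    -- Conditioning on the first draw v, occProd-∷ adds a term for each slot of e that v can fill;
    -- summing over v gives the recurrence falling (n+1) (m+1) = falling n (m+1) + (m+1) falling n m.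
    𝔼-occProd : ∀ n {m} (e : Vec (Vec Bool k) m) → (∀ u → occ (toList e) u ≤ 1) →
                𝔼 n (λ a → ℕ→ℚ (occProd (toList a) e)) ≡ ℕ→ℚ (falling n m) * prodℚ (Vec.map x e)
    𝔼-occProd zero    []      _ = refl
    𝔼-occProd zero    {suc m} (u ∷ e) _ =
      sym (trans (cong (λ c → ℕ→ℚ c * prodℚ (Vec.map x (u ∷ e))) (falling-0-suc m)) (ℚ.*-zeroˡ (prodℚ (Vec.map x (u ∷ e)))))
    𝔼-occProd (suc n) []      _ = trans (𝔼-const (suc n) 1ℚ) (sym (ℚ.*-identityʳ 1ℚ))
    𝔼-occProd (suc n) {suc m} e distinct = begin
      𝔼 (suc n) (λ a → ℕ→ℚ (occProd (toList a) e))
        ≡⟨ ℚΣ.∑-cong (λ v → cong (x v *_) (step v)) (allVecs k) ⟩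
      ∑ℚ (λ v → x v * (A + ∑ℚ (λ (w , r) → ℕ→ℚ (δ v w) * B r) (picks e))) (allVecs k)
        ≡⟨ ∑x-mixture A (picks e) proj₁ (B ∘ proj₂) ⟩
      A + ∑ℚ (λ (w , r) → x w * B r) (picks e)
        ≡⟨ cong (A +_) (ℚΣ.∑-congᴬ (All.map (λ {(w , r)} eq → trans (ℚ*.x∙yz≈y∙xz (x w) F (Π r)) (cong (F *_) eq))
                                           (prodℚ-picks e))) ⟩
      A + ∑ℚ (λ _ → F * Π e) (picks e)
        ≡⟨ cong (A +_) (trans (∑ℚ-const (F * Π e) (picks e)) (cong (λ l → ℕ→ℚ l * (F * Π e)) (length-picks e))) ⟩
      ℕ→ℚ (falling n (suc m)) * Π e + ℕ→ℚ (suc m) * (F * Π e)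
        ≡⟨ cong (ℕ→ℚ (falling n (suc m)) * Π e +_) (ℚ.*-assoc (ℕ→ℚ (suc m)) F (Π e)) ⟨
      ℕ→ℚ (falling n (suc m)) * Π e + ℕ→ℚ (suc m) * F * Π e
        ≡⟨ ℚ.*-distribʳ-+ (Π e) (ℕ→ℚ (falling n (suc m))) _ ⟨
      (ℕ→ℚ (falling n (suc m)) + ℕ→ℚ (suc m) * F) * Π e
        ≡⟨ cong (_* Π e) (trans (cong (ℕ→ℚ (falling n (suc m)) +_) (sym (ℕ→ℚ-* (suc m) (falling n m))))
                                 (sym (ℕ→ℚ-+ (falling n (suc m)) (suc m ℕ.* falling n m)))) ⟩
      ℕ→ℚ (falling n (suc m) ℕ.+ suc m ℕ.* falling n m) * Π e
        ≡⟨ cong (λ c → ℕ→ℚ c * Π e) (falling-suc n m) ⟨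
      ℕ→ℚ (falling (suc n) (suc m)) * Π e ∎
      where
      Π : ∀ {j} → Vec (Vec Bool k) j → ℚ
      Π r = prodℚ (Vec.map x r)
      F = ℕ→ℚ (falling n m)
      A = ℕ→ℚ (falling n (suc m)) * Π e
      B : Vec (Vec Bool k) m → ℚ
      B r = F * Π r

      occProd-∷-ℚ : ∀ v L → ℕ→ℚ (occProd (v ∷ L) e)
        ≡ ℕ→ℚ (occProd L e) + ∑ℚ (λ (w , r) → ℕ→ℚ (δ v w) * ℕ→ℚ (occProd L r)) (picks e)
      occProd-∷-ℚ v L = begin
        ℕ→ℚ (occProd (v ∷ L) e)                                  ≡⟨ cong ℕ→ℚ (occProd-∷ v L e distinct) ⟩
        ℕ→ℚ (occProd L e ℕ.+ occProdHead v L e)               ≡⟨ ℕ→ℚ-+ (occProd L e) _ ⟩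
        ℕ→ℚ (occProd L e) + ℕ→ℚ (occProdHead v L e)           ≡⟨ cong (ℕ→ℚ (occProd L e) +_)
                                                                       (trans (ℕ→ℚ-∑ (λ (w , r) → δ v w ℕ.* occProd L r) (picks e))
                                                                              (ℚΣ.∑-cong (λ (w , r) → ℕ→ℚ-* (δ v w) _) (picks e))) ⟩
        ℕ→ℚ (occProd L e) + ∑ℚ (λ (w , r) → ℕ→ℚ (δ v w) * ℕ→ℚ (occProd L r)) (picks e) ∎

      step : ∀ v → 𝔼 n (λ a → ℕ→ℚ (occProd (v ∷ toList a) e)) ≡ A + ∑ℚ (λ (w , r) → ℕ→ℚ (δ v w) * B r) (picks e)
      step v = begin
        𝔼 n (λ a → ℕ→ℚ (occProd (v ∷ toList a) e))
          ≡⟨ 𝔼-cong n (occProd-∷-ℚ v ∘ toList) ⟩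
        𝔼 n (λ a → ℕ→ℚ (occProd (toList a) e) + ∑ℚ (λ (w , r) → ℕ→ℚ (δ v w) * ℕ→ℚ (occProd (toList a) r)) (picks e))
          ≡⟨ 𝔼-+ n (λ a → ℕ→ℚ (occProd (toList a) e)) _ ⟩
        𝔼 n (λ a → ℕ→ℚ (occProd (toList a) e)) + 𝔼 n (λ a → ∑ℚ (λ (w , r) → ℕ→ℚ (δ v w) * ℕ→ℚ (occProd (toList a) r)) (picks e))
          ≡⟨ cong₂ _+_ (𝔼-occProd n e distinct)
                       (trans (𝔼-∑ n (λ (w , r) a → ℕ→ℚ (δ v w) * ℕ→ℚ (occProd (toList a) r)) (picks e))
                              (ℚΣ.∑-congᴬ (All.map (λ {p} → moment p) (occ-picks e)))) ⟩
        A + ∑ℚ (λ (w , r) → ℕ→ℚ (δ v w) * B r) (picks e) ∎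
        where
        moment : ∀ (p : Vec Bool k × Vec (Vec Bool k) m) →
                 (∀ u → occ (toList (proj₂ p)) u ≤ occ (toList e) u) →
                 𝔼 n (λ a → ℕ→ℚ (δ v (proj₁ p)) * ℕ→ℚ (occProd (toList a) (proj₂ p))) ≡ ℕ→ℚ (δ v (proj₁ p)) * B (proj₂ p)
        moment (w , r) r⊆e = trans (𝔼-*ˡ n (ℕ→ℚ (δ v w)) _)
          (cong (ℕ→ℚ (δ v w) *_) (𝔼-occProd n r (λ u → ℕ.≤-trans (r⊆e u) (distinct u))))

    𝔼-numShattered : ∀ n d →
      𝔼 n (λ a → ℕ→ℚ (numShattered d (famOf a))) ≡ ℕ→ℚ (falling n d) * P k d x
    𝔼-numShattered n d = begin
      𝔼 n (λ a → ℕ→ℚ (numShattered d (famOf a)))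
        ≡⟨ 𝔼-cong n (λ a → trans (cong ℕ→ℚ (numShattered-famOf d a)) (ℕ→ℚ-∑ _ (vertexSets k d))) ⟩
      𝔼 n (λ a → ∑ℚ (λ e → ℕ→ℚ (𝟙 (matShattered? e) ℕ.* occProd (toList a) e)) (vertexSets k d))
        ≡⟨ 𝔼-∑ n (λ e a → ℕ→ℚ (𝟙 (matShattered? e) ℕ.* occProd (toList a) e)) (vertexSets k d) ⟩
      ∑ℚ (λ e → 𝔼 n (λ a → ℕ→ℚ (𝟙 (matShattered? e) ℕ.* occProd (toList a) e))) (vertexSets k d)
        ≡⟨ ℚΣ.∑-congᴬ (All.map (λ {e} e⊆ → moment e e⊆) (occ-combinations d (allVecs k))) ⟩
      ∑ℚ (λ e → ℕ→ℚ (𝟙 (matShattered? e)) * (ℕ→ℚ (falling n d) * prodℚ (Vec.map x e))) (vertexSets k d)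
        ≡⟨ ℚΣ.∑-*-factor (ℕ→ℚ (falling n d)) (λ e → ℕ→ℚ (𝟙 (matShattered? e))) (λ e → prodℚ (Vec.map x e)) (vertexSets k d) ⟩
      ℕ→ℚ (falling n d) * ∑ℚ (λ e → ℕ→ℚ (𝟙 (matShattered? e)) * prodℚ (Vec.map x e)) (vertexSets k d)
        ≡⟨ cong (ℕ→ℚ (falling n d) *_) (P≡∑vertexSets d x) ⟨
      ℕ→ℚ (falling n d) * P k d x ∎
      where
      moment : ∀ (e : Vec (Vec Bool k) d) → (∀ u → occ (toList e) u ≤ occ (allVecs k) u) →
        𝔼 n (λ a → ℕ→ℚ (𝟙 (matShattered? e) ℕ.* occProd (toList a) e))
          ≡ ℕ→ℚ (𝟙 (matShattered? e)) * (ℕ→ℚ (falling n d) * prodℚ (Vec.map x e))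
      moment e e⊆ = begin
        𝔼 n (λ a → ℕ→ℚ (𝟙 (matShattered? e) ℕ.* occProd (toList a) e))
          ≡⟨ 𝔼-cong n (λ a → ℕ→ℚ-* (𝟙 (matShattered? e)) (occProd (toList a) e)) ⟩
        𝔼 n (λ a → ℕ→ℚ (𝟙 (matShattered? e)) * ℕ→ℚ (occProd (toList a) e))
          ≡⟨ 𝔼-*ˡ n (ℕ→ℚ (𝟙 (matShattered? e))) _ ⟩
        ℕ→ℚ (𝟙 (matShattered? e)) * 𝔼 n (λ a → ℕ→ℚ (occProd (toList a) e))
          ≡⟨ cong (ℕ→ℚ (𝟙 (matShattered? e)) *_)
                  (𝔼-occProd n e (λ u → subst (occ (toList e) u ≤_) (occ-allVecs k u) (e⊆ u))) ⟩
        ℕ→ℚ (𝟙 (matShattered? e)) * (ℕ→ℚ (falling n d) * prodℚ (Vec.map x e)) ∎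

falling*P≤f : ∀ {k} n d (x : Point k) → InSimplex x → ℕ→ℚ (falling n d) ℚ.* P k d x ℚ.≤ ℕ→ℚ (f n k d)
falling*P≤f n d x x∈Δ = subst (ℚ._≤ _) (𝔼-numShattered n d)
  (𝔼-≤ n (λ a → ℕ→ℚ-mono-≤ (f-upper d a)))
  where open Expectation x; open Expectation.Simplex x x∈Δ

module Population {k : ℕ} (n : ℕ) where
  open import Data.Rational.Base using (_+_; _*_)

  N : ℚ
  N = ℕ→ℚ (suc n)

  instance
    N≢0 : ℚ.NonZero N
    N≢0 = ℚ.>-nonZero (ℕ→ℚ-pos {suc n} (s≤s z≤n))

  empirical : Vec (Vec Bool k) (suc n) → Point k
  empirical a v = ℕ→ℚ (occ (toList a) v) * ℚ.1/ N

  N*empirical : ∀ a v → N * empirical a v ≡ ℕ→ℚ (occ (toList a) v)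
  N*empirical a v = begin
    N * (ℕ→ℚ (occ (toList a) v) * ℚ.1/ N)   ≡⟨ ℚ*.x∙yz≈y∙xz N (ℕ→ℚ (occ (toList a) v)) (ℚ.1/ N) ⟩
    ℕ→ℚ (occ (toList a) v) * (N * ℚ.1/ N)   ≡⟨ cong (ℕ→ℚ (occ (toList a) v) *_) (ℚ.*-inverseʳ N) ⟩
    ℕ→ℚ (occ (toList a) v) * 1ℚ             ≡⟨ ℚ.*-identityʳ _ ⟩
    ℕ→ℚ (occ (toList a) v)                  ∎
    where
    open ≡-Reasoning

  N*-injective : ∀ {p q} → N * p ≡ N * q → p ≡ q
  N*-injective eq = ℚ.≤-antisym (ℚ.*-cancelˡ-≤-pos N {{ℚ.positive (ℕ→ℚ-pos {suc n} (s≤s z≤n))}} (ℚ.≤-reflexive eq))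
                                (ℚ.*-cancelˡ-≤-pos N {{ℚ.positive (ℕ→ℚ-pos {suc n} (s≤s z≤n))}} (ℚ.≤-reflexive (sym eq)))

  empirical-InSimplex : ∀ a → InSimplex (empirical a)
  empirical-InSimplex a = nonNeg , N*-injective (begin
    N * ∑ℚ (empirical a) (allVecs k)                ≡⟨ ℚΣ.∑-*ˡ N (empirical a) (allVecs k) ⟨
    ∑ℚ (λ v → N * empirical a v) (allVecs k)        ≡⟨ ℚΣ.∑-cong (N*empirical a) (allVecs k) ⟩
    ∑ℚ (ℕ→ℚ ∘ occ (toList a)) (allVecs k)           ≡⟨ ℕ→ℚ-∑ (occ (toList a)) (allVecs k) ⟨
    ℕ→ℚ (∑ℕ (occ (toList a)) (allVecs k))           ≡⟨ cong ℕ→ℚ (trans (∑-occ (toList a)) (Vec.length-toList a)) ⟩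
    N                                               ≡⟨ ℚ.*-identityʳ N ⟨
    N * 1ℚ                                          ∎)
    where
    open ≡-Reasoning
    nonNeg : ∀ v → 0ℚ ℚ.≤ empirical a v
    nonNeg v = ℚ.*-cancelˡ-≤-pos N {{ℚ.positive (ℕ→ℚ-pos {suc n} (s≤s z≤n))}}
      (subst₂ ℚ._≤_ (sym (ℚ.*-zeroʳ N)) (sym (N*empirical a v)) (ℕ→ℚ-nonNeg (occ (toList a) v)))

  empirical-InLattice : ∀ a → InLattice (suc n) (empirical a)
  empirical-InLattice a v = ℤ.+ occ (toList a) v , N*empirical a v

  lattice-realised : ∀ (x : Point k) → InSimplex x → InLattice (suc n) x →
                     ∃ λ (a : Vec (Vec Bool k) (suc n)) → ∀ v → N * x v ≡ ℕ→ℚ (occ (toList a) v)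
  lattice-realised x (x≥0 , ∑x≡1) lat = a , λ v → trans (N*x≡count v) (cong ℕ→ℚ (sym (occ-a v)))
    where
    open ≡-Reasoning
    natural : ∀ v → ∃ λ c → N * x v ≡ ℕ→ℚ c
    natural v with lat v
    ... | ℤ.+ c      , eq = c , eq
    ... | ℤ.-[1+ c ] , eq = ⊥-elim (ℚ.<-irrefl refl (ℚ.≤-<-trans N*x≥0 (subst (ℚ._< 0ℚ) (sym eq) (ℚ.neg-antimono-< (ℕ→ℚ-pos {suc c} (s≤s z≤n))))))
      where
      N*x≥0 : 0ℚ ℚ.≤ N * x v
      N*x≥0 = subst (ℚ._≤ N * x v) (ℚ.*-zeroʳ N) (ℚ.*-monoˡ-≤-nonNeg N {{ℚ.nonNegative (ℕ→ℚ-nonNeg (suc n))}} (x≥0 v))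

    count : Vec Bool k → ℕ
    count v = proj₁ (natural v)
    N*x≡count : ∀ v → N * x v ≡ ℕ→ℚ (count v)
    N*x≡count v = proj₂ (natural v)

    L : List (Vec Bool k)
    L = List.concatMap (λ v → List.replicate (count v) v) (allVecs k)

    occ-L : ∀ u → occ L u ≡ count u
    occ-L u = begin
      occ L u                                           ≡⟨ occ-concatMap (λ v → List.replicate (count v) v) (allVecs k) u ⟩
      ∑ℕ (λ v → occ (List.replicate (count v) v) u) (allVecs k) ≡⟨ ℕΣ.∑-cong (λ v → occ-replicate (count v) v u) (allVecs k) ⟩
      ∑ℕ (λ v → count v ℕ.* δ v u) (allVecs k)          ≡⟨ ∑-sift count (allVecs k) u ⟩
      occ (allVecs k) u ℕ.* count u                     ≡⟨ cong (ℕ._* count u) (occ-allVecs k u) ⟩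
      1 ℕ.* count u                                     ≡⟨ ℕ.*-identityˡ (count u) ⟩
      count u                                           ∎

    length-L : length L ≡ suc n
    length-L = ℕ→ℚ-injective (begin
      ℕ→ℚ (length L)                         ≡⟨ cong ℕ→ℚ (trans (sym (∑-occ L)) (ℕΣ.∑-cong occ-L (allVecs k))) ⟩
      ℕ→ℚ (∑ℕ count (allVecs k))             ≡⟨ ℕ→ℚ-∑ count (allVecs k) ⟩
      ∑ℚ (ℕ→ℚ ∘ count) (allVecs k)           ≡⟨ ℚΣ.∑-cong (sym ∘ N*x≡count) (allVecs k) ⟩
      ∑ℚ (λ v → N * x v) (allVecs k)         ≡⟨ ℚΣ.∑-*ˡ N x (allVecs k) ⟩
      N * ∑ℚ x (allVecs k)                   ≡⟨ cong (N *_) ∑x≡1 ⟩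
      N * 1ℚ                                 ≡⟨ ℚ.*-identityʳ N ⟩
      N                                      ∎)

    a : Vec (Vec Bool k) (suc n)
    a = Vec.cast length-L (Vec.fromList L)

    occ-a : ∀ v → occ (toList a) v ≡ count v
    occ-a v = trans (cong (λ l → occ l v) (trans (Vec.toList-cast length-L (Vec.fromList L)) (Vec.toList∘fromList L))) (occ-L v)

open import Data.Nat using (_*_; _^_)

lemma2p3 : (n k d : ℕ) → 1 ≤ d → d ≤ n → 2 ^ d ≤ k →
    LagTimesLE k d (d ! * (n C d)) (ℕ→ℚ (f n k d))
    × LagTimesGE k d (n ^ d) (ℕ→ℚ (f n k d))
    × ((LagTimesLE k d (n ^ d) (ℕ→ℚ (f n k d)) × LagTimesGE k d (n ^ d) (ℕ→ℚ (f n k d)))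
       ⇔ (∃ λ x → MaxAt k d x × InLattice n x))
lemma2p3 zero    k d 1≤d d≤0 _ = ⊥-elim (ℕ.<⇒≱ 1≤d d≤0)
lemma2p3 (suc n) k d _   _   _ = falling*P≤f (suc n) d , upper , mk⇔ maximiser fromMaximiser
  where
  open Population {k} n
  F = ℕ→ℚ (f (suc n) k d)
  Nᵈ = ℕ→ℚ (suc n ^ d)

  cancel-Nᵈ : ∀ {p q} → Nᵈ ℚ.* p ℚ.≤ Nᵈ ℚ.* q → p ℚ.≤ q
  cancel-Nᵈ = ℚ.*-cancelˡ-≤-pos Nᵈ {{ℚ.positive (ℕ→ℚ-pos {suc n ^ d} (ℕ.m^n>0 (suc n) d))}}

  a* = proj₁ (f-attained (suc n) d)

  F≡ : F ≡ Nᵈ ℚ.* P k d (empirical a*)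
  F≡ = trans (cong ℕ→ℚ (sym (proj₂ (f-attained (suc n) d)))) (numShattered≡P d a* (empirical a*) (N*empirical a*))

  upper : LagTimesGE k d (suc n ^ d) F
  upper r r<F = empirical a* , empirical-InSimplex a* , subst (r ℚ.<_) F≡ r<F

  maximiser : LagTimesLE k d (suc n ^ d) F × LagTimesGE k d (suc n ^ d) F →
              ∃ λ x → MaxAt k d x × InLattice (suc n) x
  maximiser (le , _) = empirical a*
    , (empirical-InSimplex a* , λ y y∈Δ → cancel-Nᵈ (subst (Nᵈ ℚ.* P k d y ℚ.≤_) F≡ (le y y∈Δ)))
    , empirical-InLattice a*

  fromMaximiser : (∃ λ x → MaxAt k d x × InLattice (suc n) x) →
                  LagTimesLE k d (suc n ^ d) F × LagTimesGE k d (suc n ^ d) F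
  fromMaximiser (x , (x∈Δ , x-max) , x∈lattice) = le , upper
    where
    a = proj₁ (lattice-realised x x∈Δ x∈lattice)
    le : LagTimesLE k d (suc n ^ d) F
    le y y∈Δ = ℚ.≤-trans (ℚ.*-monoˡ-≤-nonNeg Nᵈ {{ℚ.nonNegative (ℕ→ℚ-nonNeg (suc n ^ d))}} (x-max y y∈Δ))
      (subst (ℚ._≤ F) (numShattered≡P d a x (proj₂ (lattice-realised x x∈Δ x∈lattice)))
             (ℕ→ℚ-mono-≤ (f-upper d a)))
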